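{- Let $N$ be a binary matroid and $a \in E(N)$ such that $N \backslash a \cong F_7^*$. If $N/a$ has no minor isomorphic to $F_7$ or $F_7^*$, then $N/a$ is graphic.
   Context: $F_7$ is the Fano matroid and $F_7^*$ its dual. The matroid $N/a$ with $N\backslash a \cong F$ is called an elementary quotient of $F$. -}

module Defs where

open import Data.Nat using (ℕ; zero; suc; _<?_; s≤s)
open import Data.Fin using (Fin; zero; suc; toℕ; fromℕ<; punchOut; _≟_)
open import Data.Bool using (Bool; true; false; _∧_; _∨_; _xor_; if_then_else_)
open import Data.Product using (Σ; ∃; _×_; _,_)
open import Relation.Nullary using (¬_; yes; no; ⌊_⌋)
open import Relation.Binary.PropositionalEquality using (_≡_)
open import Function.Bundles using (_⇔_; _↔_; Inverse)
open import Function.Definitions using (Injective)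

Sub : ℕ → Set
Sub n = Fin n → Bool

_⊆_ : ∀ {n} → Sub n → Sub n → Set
X ⊆ Y = ∀ i → X i ≡ true → Y i ≡ true

_∪_ : ∀ {n} → Sub n → Sub n → Sub n
(X ∪ Y) i = X i ∨ Y i

IsEmpty : ∀ {n} → Sub n → Set
IsEmpty X = ∀ i → X i ≡ false

⁅_⁆ : ∀ {n} → Fin n → Sub n
⁅ a ⁆ i = ⌊ a ≟ i ⌋

xorSum : ∀ {n} → (Fin n → Bool) → Bool
xorSum {zero}  f = false
xorSum {suc n} f = f zero xor xorSum (λ i → f (suc i))

anyFin : ∀ {n} → (Fin n → Bool) → Bool
anyFin {zero}  f = false
anyFin {suc n} f = f zero ∨ anyFin (λ i → f (suc i))

img : ∀ {k n} → (Fin k → Fin n) → Sub k → Sub n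
img f X j = anyFin (λ i → X i ∧ ⌊ f i ≟ j ⌋)

record Matroid (n : ℕ) : Set₁ where
  field
    Indep : Sub n → Set
open Matroid public

MaxIndepIn : ∀ {n} → Matroid n → Sub n → Sub n → Set
MaxIndepIn M T B =
  B ⊆ T × Indep M B × (∀ Y → B ⊆ Y → Y ⊆ T → Indep M Y → Y ⊆ B)

IsBasis : ∀ {n} → Matroid n → Sub n → Set
IsBasis M B = MaxIndepIn M (λ _ → true) B

_* : ∀ {n} → Matroid n → Matroid n
Indep (M *) X = ∃ λ B → IsBasis M B × (∀ i → X i ≡ true → B i ≡ false)

ColIndep : ∀ {r n} → (Fin r → Fin n → Bool) → Sub n → Set
ColIndep A X =
  ∀ Y → Y ⊆ X → (∀ j → xorSum (λ i → Y i ∧ A j i) ≡ false) → IsEmpty Y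

columnMatroid : ∀ {r n} → (Fin r → Fin n → Bool) → Matroid n
Indep (columnMatroid A) = ColIndep A

IsBinary : ∀ {n} → Matroid n → Set
IsBinary {n} M =
  Σ ℕ λ r → Σ (Fin r → Fin n → Bool) λ A → ∀ X → Indep M X ⇔ ColIndep A X

_≅_ : ∀ {n m} → Matroid n → Matroid m → Set
_≅_ {n} {m} M M' =
  Σ (Fin n ↔ Fin m) λ σ → ∀ X → Indep M X ⇔ Indep M' (λ j → X (Inverse.from σ j))

-- extend X ⊆ E − a to E, with value b at a
liftAt : ∀ {n} → Fin (suc n) → Bool → Sub n → Sub (suc n)
liftAt a b X j with a ≟ j
... | yes _ = b
... | no ne = X (punchOut ne)

_∖_ : ∀ {n} → Matroid (suc n) → Fin (suc n) → Matroid n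
Indep (N ∖ a) X = Indep N (liftAt a false X)

_/_ : ∀ {n} → Matroid (suc n) → Fin (suc n) → Matroid n
Indep (N / a) X =
  ∃ λ B → MaxIndepIn N ⁅ a ⁆ B × Indep N (liftAt a false X ∪ B)

-- Minors: M has a minor isomorphic to F (F on Fin k).
-- M/C \ D with D the complement of C ∪ image f; independence in M/C
-- is "X ∪ B independent in M" for a basis B of C.

HasMinor : ∀ {n k} → Matroid n → Matroid k → Set
HasMinor {n} {k} M F =
  Σ (Sub n) λ C → Σ (Sub n) λ B → MaxIndepIn M C B ×
  Σ (Fin k → Fin n) λ f → Injective _≡_ _≡_ f × (∀ i → C (f i) ≡ false) ×
  (∀ X → Indep F X ⇔ Indep M (img f X ∪ B))

-- Graphic matroids: cycle matroids of (multi)graphs with loops allowed.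
-- A graph on vertex set Fin v with edge set Fin n is given by the
-- endpoint pair of each edge.

next : ∀ {k} → Fin (suc k) → Fin (suc k)
next {k} i with suc (toℕ i) <? suc k
... | yes p = fromℕ< p
... | no _  = zero

Joins : ∀ {n v} → (Fin n → Fin v × Fin v) → Fin n → Fin v → Fin v → Set
Joins ends e x y = (ends e ≡ (x , y)) Data.Sum.⊎ (ends e ≡ (y , x))
  where import Data.Sum

HasCycleIn : ∀ {n v} → (Fin n → Fin v × Fin v) → Sub n → Set
HasCycleIn {n} {v} ends X =
  Σ ℕ λ k → Σ (Fin (suc k) → Fin v) λ vs → Σ (Fin (suc k) → Fin n) λ es →
    Injective _≡_ _≡_ vs × Injective _≡_ _≡_ es ×
    (∀ i → X (es i) ≡ true) × (∀ i → Joins ends (es i) (vs i) (vs (next i)))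

cycleMatroid : ∀ {n v} → (Fin n → Fin v × Fin v) → Matroid n
Indep (cycleMatroid ends) X = ¬ HasCycleIn ends X

IsGraphic : ∀ {n} → Matroid n → Set
IsGraphic {n} M =
  Σ ℕ λ v → Σ (Fin n → Fin v × Fin v) λ ends →
    ∀ X → Indep M X ⇔ Indep (cycleMatroid ends) X

-- The Fano matroid: columns are the 7 nonzero vectors of GF(2)^3
-- (column i is the binary expansion of i+1, row j = bit j)

fanoMatrix : Fin 3 → Fin 7 → Bool
fanoMatrix zero       i = bit0 i
  where
  bit0 : Fin 7 → Bool
  bit0 i = ⌊ toℕ i Data.Nat.≟ 0 ⌋ ∨ ⌊ toℕ i Data.Nat.≟ 2 ⌋ ∨ ⌊ toℕ i Data.Nat.≟ 4 ⌋ ∨ ⌊ toℕ i Data.Nat.≟ 6 ⌋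
    where import Data.Nat
fanoMatrix (suc zero) i = ⌊ toℕ i Data.Nat.≟ 1 ⌋ ∨ ⌊ toℕ i Data.Nat.≟ 2 ⌋ ∨ ⌊ toℕ i Data.Nat.≟ 5 ⌋ ∨ ⌊ toℕ i Data.Nat.≟ 6 ⌋
  where import Data.Nat
fanoMatrix (suc (suc zero)) i = ⌊ toℕ i Data.Nat.≟ 3 ⌋ ∨ ⌊ toℕ i Data.Nat.≟ 4 ⌋ ∨ ⌊ toℕ i Data.Nat.≟ 5 ⌋ ∨ ⌊ toℕ i Data.Nat.≟ 6 ⌋
  where import Data.Nat

F₇ : Matroid 7
F₇ = columnMatroid fanoMatrix

F₇* : Matroid 7
F₇* = F₇ *

-- N ∖ a is isomorphic to F₇*, whose cycle space (the row space of the Fano matrix) is spanned by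
-- the fundamental circuits C₄, C₅, C₆ of the basis B₀ = {0,1,2,3}; as N is binary, this pins down
-- the cycles of N ∖ a. If a is a loop or a coloop of N, then N / a has the independent sets of
-- N ∖ a ≅ F₇*. Otherwise a lies on a cycle W₀ ∪ {a} of N, and the cycles of N / a are the sets Z
-- such that Z or Z ⊕ W₀ is a cycle of N ∖ a; so N / a only depends on the coset of W₀ modulo the
-- cycle space of F₇*. Each of the sixteen cosets meets the subsets of B₀ exactly once: the trivial
-- coset would make a a loop, the coset of {0,1,2} makes N / a isomorphic to F₇, and each of the
-- other fourteen makes N / a the cycle matroid of an explicit graph on four vertices.

module Submission where

open import Defs
open import Algebra.Bundles using (CommutativeRing)
open import Data.Bool using (Bool; true; false; _∧_; _∨_; _xor_; not)
open import Data.Bool.ListAction using (any)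
open import Data.Bool.Properties
  using (xor-assoc; xor-comm; xor-identityʳ; xor-same; ∧-distribʳ-xor; ∨-identityʳ; ∨-zeroʳ;
         xor-∧-commutativeRing)
open import Data.Empty using (⊥; ⊥-elim)
open import Data.Fin
  using (Fin; zero; suc; punchIn; punchOut; toℕ; fromℕ; inject₁; _≟_; #_)
open import Data.Fin.Permutation using (↔⇒≡)
open import Data.Fin.Properties
  using (punchInᵢ≢i; punchIn-punchOut; punchOut-punchIn; punchOut-cong; suc-injective;
         toℕ-injective; toℕ-fromℕ<; toℕ-inject₁; toℕ<n; toℕ-fromℕ)
open import Data.List using (List; []; _∷_)
open import Data.Nat using (ℕ; zero; suc; _<?_; _≤_; _<_; s≤s)
open import Data.Nat.Properties using (n≮n)
open import Data.Product using (Σ; ∃; _×_; _,_; proj₁; proj₂)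
open import Data.Sum using (_⊎_; inj₁; inj₂) renaming (map to ⊎-map)
open import Data.Vec using (Vec; lookup; []; _∷_)
open import Function using (_∘_; id)
open import Function.Bundles using (_⇔_; mk⇔; Equivalence; _↔_; Inverse)
open import Function.Definitions using (Injective)
open import Function.Properties.Equivalence using () renaming (trans to ⇔-trans)
open import Relation.Binary.PropositionalEquality
  using (_≡_; refl; sym; trans; cong; cong₂; subst; _≗_; _≢_; module ≡-Reasoning)
open import Relation.Nullary using (¬_; yes; no; ⌊_⌋)
open import Algebra.Properties.CommutativeSemigroup
  (CommutativeRing.+-commutativeSemigroup xor-∧-commutativeRing) using (interchange; x∙yz≈y∙xz)

open ≡-Reasoning

private
  variable
    k m n r v : ℕ

-- Subsets of Fin n and GF(2)-sums

infixr 22 _⊕_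
infixr 23 _·_
infixl 24 _─_ _∪｛_｝

_⊕_ : Sub n → Sub n → Sub n
(X ⊕ Y) i = X i xor Y i

_·_ : Bool → Sub n → Sub n
(b · X) i = b ∧ X i

∅ : Sub n
∅ _ = false

_─_ : Sub n → Fin n → Sub n
(X ─ x) i = X i ∧ not ⌊ x ≟ i ⌋

_∪｛_｝ : Sub n → Fin n → Sub n
(X ∪｛ x ｝) i = X i ∨ ⌊ x ≟ i ⌋

fromList : List (Fin n) → Sub n
fromList xs i = any (λ x → ⌊ x ≟ i ⌋) xs

⊆-refl : {X : Sub n} → X ⊆ X
⊆-refl _ Xi = Xi

≗-⊆ : {W V X : Sub n} → W ≗ V → V ⊆ X → W ⊆ X
≗-⊆ W≗V V⊆X i Wi = V⊆X i (trans (sym (W≗V i)) Wi)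

⊕-cancelʳ : (Y Z : Sub n) → (Y ⊕ Z) ⊕ Z ≗ Y
⊕-cancelʳ Y Z i = trans (xor-assoc (Y i) (Z i) (Z i))
                        (trans (cong (Y i xor_) (xor-same (Z i))) (xor-identityʳ (Y i)))

∧-true : ∀ {a b} → a ∧ b ≡ true → a ≡ true × b ≡ true
∧-true {true} {true} _ = refl , refl

∨-true : ∀ {a b} → a ∨ b ≡ true → a ≡ true ⊎ b ≡ true
∨-true {true}  _ = inj₁ refl
∨-true {false} e = inj₂ e

true≢false : ∀ {b} → b ≡ true → b ≡ false → ⊥
true≢false refl ()

not-true : ∀ {b} → not b ≡ true → b ≡ false
not-true {false} _ = refl

not-false : ∀ {b} → not b ≡ false → b ≡ true
not-false {true} _ = refl

xor≡false⇒≡ : ∀ {a b} → a xor b ≡ false → a ≡ b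
xor≡false⇒≡ {false} {false} _ = refl
xor≡false⇒≡ {true}  {true}  _ = refl

bool-ext : ∀ {a b} → (a ≡ true → b ≡ true) → (b ≡ true → a ≡ true) → a ≡ b
bool-ext {false} {false} _ _ = refl
bool-ext {false} {true}  _ b⇒a = b⇒a refl
bool-ext {true}  {false} a⇒b _ = sym (a⇒b refl)
bool-ext {true}  {true}  _ _ = refl

xor-cancelˡ : ∀ a b → a xor (a xor b) ≡ b
xor-cancelˡ a b = trans (sym (xor-assoc a a b)) (cong (_xor b) (xor-same a))

xor-telescope : ∀ a b c → (a xor b) xor (b xor c) ≡ a xor c
xor-telescope a b c = trans (xor-assoc a b (b xor c)) (cong (a xor_) (xor-cancelˡ b c))

⊎⇔∨ : ∀ {P Q : Set} {p q : Bool} → P ⇔ p ≡ true → Q ⇔ q ≡ true → (P ⊎ Q) ⇔ (p ∨ q ≡ true)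
⊎⇔∨ {p = p} P⇔ Q⇔ = mk⇔
  (λ { (inj₁ P) → subst (λ b → b ∨ _ ≡ true) (sym (Equivalence.to P⇔ P)) refl
     ; (inj₂ Q) → trans (cong (p ∨_) (Equivalence.to Q⇔ Q)) (∨-zeroʳ p) })
  (λ p∨q → ⊎-map (Equivalence.from P⇔) (Equivalence.from Q⇔) (∨-true p∨q))

≟-refl : (i : Fin n) → ⌊ i ≟ i ⌋ ≡ true
≟-refl i with i ≟ i
... | yes _ = refl
... | no i≢i = ⊥-elim (i≢i refl)

≟-≢ : {i j : Fin n} → i ≢ j → ⌊ i ≟ j ⌋ ≡ false
≟-≢ {i = i} {j} i≢j with i ≟ j
... | yes i≡j = ⊥-elim (i≢j i≡j)
... | no _ = refl

≟-sound : {i j : Fin n} → ⌊ i ≟ j ⌋ ≡ true → i ≡ j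
≟-sound {i = i} {j} eq with i ≟ j
... | yes i≡j = i≡j

xorSum-cong : {f g : Fin n → Bool} → f ≗ g → xorSum f ≡ xorSum g
xorSum-cong {zero}  f≗g = refl
xorSum-cong {suc n} f≗g = cong₂ _xor_ (f≗g zero) (xorSum-cong (λ i → f≗g (suc i)))

xorSum-xor : (f g : Fin n → Bool) → xorSum (λ i → f i xor g i) ≡ xorSum f xor xorSum g
xorSum-xor {zero}  f g = refl
xorSum-xor {suc n} f g =
  trans (cong ((f zero xor g zero) xor_) (xorSum-xor (λ i → f (suc i)) (λ i → g (suc i))))
        (interchange (f zero) (g zero) _ _)

xorSum-false : (f : Fin n → Bool) → (∀ i → f i ≡ false) → xorSum f ≡ false
xorSum-false {zero}  f f≡false = refl
xorSum-false {suc n} f f≡false rewrite f≡false zero =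
  xorSum-false (λ i → f (suc i)) (λ i → f≡false (suc i))

xorSum-punchIn : (a : Fin (suc n)) (f : Fin (suc n) → Bool) →
                 xorSum f ≡ f a xor xorSum (λ i → f (punchIn a i))
xorSum-punchIn zero f = refl
xorSum-punchIn {suc n} (suc a) f =
  trans (cong (f zero xor_) (xorSum-punchIn a (λ i → f (suc i))))
        (x∙yz≈y∙xz (f zero) (f (suc a)) _)

xorSum-indicator : (c : Fin n) (h : Fin n → Bool) → xorSum (λ i → ⌊ c ≟ i ⌋ ∧ h i) ≡ h c
xorSum-indicator {suc n} c h = begin
  xorSum (λ i → ⌊ c ≟ i ⌋ ∧ h i)
    ≡⟨ xorSum-punchIn c (λ i → ⌊ c ≟ i ⌋ ∧ h i) ⟩
  (⌊ c ≟ c ⌋ ∧ h c) xor xorSum (λ i → ⌊ c ≟ punchIn c i ⌋ ∧ h (punchIn c i))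
    ≡⟨ cong₂ _xor_ (cong (_∧ h c) (≟-refl c)) (xorSum-false _ off-c) ⟩
  h c xor false
    ≡⟨ xor-identityʳ (h c) ⟩
  h c ∎
  where
  off-c : ∀ i → ⌊ c ≟ punchIn c i ⌋ ∧ h (punchIn c i) ≡ false
  off-c i = cong (_∧ h (punchIn c i)) (≟-≢ (λ c≡ → punchInᵢ≢i c i (sym c≡)))

-- Deciding statements about Fin n and Sub n by enumeration

Extensionalᵇ : (Sub n → Bool) → Set
Extensionalᵇ p = ∀ {X Y} → X ≗ Y → p X ≡ p Y

allFin : (Fin n → Bool) → Bool
allFin {zero}  f = true
allFin {suc n} f = f zero ∧ allFin (λ i → f (suc i))

allFin-sound : (f : Fin n → Bool) → allFin f ≡ true → ∀ i → f i ≡ true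
allFin-sound f all zero    = proj₁ (∧-true all)
allFin-sound f all (suc i) = allFin-sound (λ i → f (suc i)) (proj₂ (∧-true {f zero} all)) i

allFin-complete : (f : Fin n → Bool) → (∀ i → f i ≡ true) → allFin f ≡ true
allFin-complete {zero}  f all = refl
allFin-complete {suc n} f all rewrite all zero = allFin-complete (λ i → f (suc i)) (λ i → all (suc i))

allFin-cong : {f g : Fin n → Bool} → f ≗ g → allFin f ≡ allFin g
allFin-cong {zero}  f≗g = refl
allFin-cong {suc n} f≗g = cong₂ _∧_ (f≗g zero) (allFin-cong (λ i → f≗g (suc i)))

anyFin-sound : (f : Fin n → Bool) → anyFin f ≡ true → ∃ λ i → f i ≡ true
anyFin-sound {suc n} f any with f zero in f0
... | true  = zero , f0
... | false with anyFin-sound (λ i → f (suc i)) any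
... | i , fi = suc i , fi

anyFin-complete : (f : Fin n → Bool) (i : Fin n) → f i ≡ true → anyFin f ≡ true
anyFin-complete f zero    fi rewrite fi = refl
anyFin-complete f (suc i) fi with f zero
... | true  = refl
... | false = anyFin-complete (λ i → f (suc i)) i fi

anyFin-false : (f : Fin n → Bool) → anyFin f ≡ false → ∀ i → f i ≡ false
anyFin-false f none i with f i in fi
... | false = refl
... | true  with () ← trans (sym (anyFin-complete f i fi)) none

anyFin-cong : {f g : Fin n → Bool} → f ≗ g → anyFin f ≡ anyFin g
anyFin-cong {zero}  f≗g = refl
anyFin-cong {suc n} f≗g = cong₂ _∨_ (f≗g zero) (anyFin-cong (λ i → f≗g (suc i)))

_◂_ : Bool → Sub n → Sub (suc n)
(b ◂ X) zero    = b
(b ◂ X) (suc i) = X i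

allSub : (Sub n → Bool) → Bool
allSub {zero}  p = p ∅
allSub {suc n} p = allSub (λ X → p (false ◂ X)) ∧ allSub (λ X → p (true ◂ X))

◂-η : (X : Sub (suc n)) → X ≗ X zero ◂ (λ i → X (suc i))
◂-η X zero    = refl
◂-η X (suc i) = refl

◂-cong : ∀ b {Y Z : Sub n} → Y ≗ Z → b ◂ Y ≗ b ◂ Z
◂-cong b Y≗Z zero    = refl
◂-cong b Y≗Z (suc i) = Y≗Z i

allSub-sound : (p : Sub n → Bool) → Extensionalᵇ p → allSub p ≡ true → ∀ X → p X ≡ true
allSub-sound {zero}  p ext all X = trans (ext (λ ())) all
allSub-sound {suc n} p ext all X = trans (ext (◂-η X)) (half (X zero) (λ i → X (suc i)))
  where
  half : ∀ b (Y : Sub n) → p (b ◂ Y) ≡ true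
  half false = allSub-sound _ (λ eq → ext (◂-cong false eq)) (proj₁ (∧-true all))
  half true  = allSub-sound _ (λ eq → ext (◂-cong true eq)) (proj₂ (∧-true {allSub (λ Y → p (false ◂ Y))} all))

allSub-false : (p : Sub n → Bool) → allSub p ≡ false → ∃ λ X → p X ≡ false
allSub-false {zero}  p none = ∅ , none
allSub-false {suc n} p none with allSub (λ X → p (false ◂ X)) in all0
... | false = let X , pX = allSub-false _ all0 in false ◂ X , pX
... | true  = let X , pX = allSub-false _ none in true ◂ X , pX

allSub-cong : {p q : Sub n → Bool} → (∀ X → p X ≡ q X) → allSub p ≡ allSub q
allSub-cong {zero}  p≡q = p≡q ∅
allSub-cong {suc n} p≡q =
  cong₂ _∧_ (allSub-cong (λ X → p≡q (false ◂ X))) (allSub-cong (λ X → p≡q (true ◂ X)))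

allSub-≡ : (p q : Sub n → Bool) → Extensionalᵇ p → Extensionalᵇ q →
           allSub (λ Z → not (p Z xor q Z)) ≡ true → ∀ Z → p Z ≡ q Z
allSub-≡ p q p-ext q-ext all Z =
  xor≡false⇒≡ (not-true (allSub-sound _ ext all Z))
  where
  ext : Extensionalᵇ (λ Z → not (p Z xor q Z))
  ext Y≗Z = cong₂ (λ a b → not (a xor b)) (p-ext Y≗Z) (q-ext Y≗Z)

_⊆?_ : Sub n → Sub n → Bool
W ⊆? X = allFin (λ i → not (W i) ∨ X i)

⊆?-sound : {W X : Sub n} → W ⊆? X ≡ true → W ⊆ X
⊆?-sound {W = W} {X} W⊆?X i Wi with allFin-sound _ W⊆?X i
... | Xi rewrite Wi = Xi

⊆?-complete : {W X : Sub n} → W ⊆ X → W ⊆? X ≡ true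
⊆?-complete {W = W} {X} W⊆X = allFin-complete _ pointwise
  where
  pointwise : ∀ i → not (W i) ∨ X i ≡ true
  pointwise i with W i in Wi
  ... | false = refl
  ... | true  = W⊆X i Wi

⊆?-cong : {W W′ X X′ : Sub n} → W ≗ W′ → X ≗ X′ → (W ⊆? X) ≡ (W′ ⊆? X′)
⊆?-cong W≗ X≗ = allFin-cong (λ i → cong₂ (λ w x → not w ∨ x) (W≗ i) (X≗ i))

-- Cycles and independent sets of column matroids

Matrix : ℕ → ℕ → Set
Matrix r n = Fin r → Fin n → Bool

IsCycle : Matrix r n → Sub n → Set
IsCycle A Y = ∀ j → xorSum (λ i → Y i ∧ A j i) ≡ false

-- ColIndep A is, by definition, Acyclic (IsCycle A).
Acyclic : (Sub n → Set) → Sub n → Set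
Acyclic Cyc X = ∀ Y → Y ⊆ X → Cyc Y → IsEmpty Y

Extensional : (Sub n → Set) → Set
Extensional P = ∀ {X Y} → X ≗ Y → P X → P Y

Acyclic-mono : {Cyc : Sub n → Set} {X Y : Sub n} → Y ⊆ X → Acyclic Cyc X → Acyclic Cyc Y
Acyclic-mono Y⊆X acyclic W W⊆Y = acyclic W (λ i Wi → Y⊆X i (W⊆Y i Wi))

Acyclic-antitone : {C D : Sub n → Set} {X : Sub n} → (∀ Y → D Y → C Y) → Acyclic C X → Acyclic D X
Acyclic-antitone D⇒C acyclic Y Y⊆X dY = acyclic Y Y⊆X (D⇒C Y dY)

IsCycle-cong : (A : Matrix r n) {X Y : Sub n} → X ≗ Y → IsCycle A X → IsCycle A Y
IsCycle-cong A X≗Y cyc j = trans (xorSum-cong (λ i → cong (_∧ A j i) (sym (X≗Y i)))) (cyc j)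

IsCycle-⊕ : (A : Matrix r n) {X Y : Sub n} → IsCycle A X → IsCycle A Y → IsCycle A (X ⊕ Y)
IsCycle-⊕ A {X} {Y} cycX cycY j =
  trans (xorSum-cong (λ i → ∧-distribʳ-xor (A j i) (X i) (Y i)))
        (trans (xorSum-xor (λ i → X i ∧ A j i) (λ i → Y i ∧ A j i)) (cong₂ _xor_ (cycX j) (cycY j)))

IsCycle-∅ : (A : Matrix r n) → IsCycle A ∅
IsCycle-∅ {n = n} A j = xorSum-false {n} _ (λ _ → refl)

isCycle? : Matrix r n → Sub n → Bool
isCycle? A Y = allFin (λ j → not (xorSum (λ i → Y i ∧ A j i)))

isCycle?-sound : (A : Matrix r n) {Y : Sub n} → isCycle? A Y ≡ true → IsCycle A Y
isCycle?-sound A cyc j = not-true (allFin-sound _ cyc j)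

isCycle?-complete : (A : Matrix r n) {Y : Sub n} → IsCycle A Y → isCycle? A Y ≡ true
isCycle?-complete A cyc = allFin-complete _ (λ j → cong not (cyc j))

isCycle?-cong : (A : Matrix r n) → Extensionalᵇ (isCycle? A)
isCycle?-cong A X≗Y = allFin-cong (λ j → cong not (xorSum-cong (λ i → cong (_∧ A j i) (X≗Y i))))

colIndep? : Matrix r n → Sub n → Bool
colIndep? A X = allSub (λ W → not (W ⊆? X ∧ isCycle? A W ∧ anyFin W))

colIndep?-cong : (A : Matrix r n) → Extensionalᵇ (colIndep? A)
colIndep?-cong A X≗Y =
  allSub-cong (λ W → cong (λ s → not (s ∧ isCycle? A W ∧ anyFin W)) (⊆?-cong (λ _ → refl) X≗Y))

NonemptyCycleIn : Matrix r n → Sub n → Set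
NonemptyCycleIn {n = n} A X = Σ (Sub n) λ W → W ⊆ X × IsCycle A W × ∃ λ i → W i ≡ true

colIndep?-false : (A : Matrix r n) (X : Sub n) → colIndep? A X ≡ false → NonemptyCycleIn A X
colIndep?-false A X dep with allSub-false _ dep
... | W , witness with ∧-true (not-false witness)
... | W⊆X , cyc∧nonempty with ∧-true cyc∧nonempty
... | cyc , nonempty = W , ⊆?-sound W⊆X , isCycle?-sound A cyc , anyFin-sound W nonempty

colIndep?-sound : (A : Matrix r n) (X : Sub n) → colIndep? A X ≡ true → ColIndep A X
colIndep?-sound A X indep W W⊆X cyc
  with allSub-sound _ extensional indep W
  where
  extensional : Extensionalᵇ (λ W → not (W ⊆? X ∧ isCycle? A W ∧ anyFin W))
  extensional V≗ = cong₂ (λ s c → not (s ∧ c)) (⊆?-cong V≗ (λ _ → refl))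
                         (cong₂ _∧_ (isCycle?-cong A V≗) (anyFin-cong V≗))
... | test rewrite ⊆?-complete W⊆X | isCycle?-complete A cyc = anyFin-false W (not-true test)

colIndep-or-cycle : (A : Matrix r n) (X : Sub n) → ColIndep A X ⊎ NonemptyCycleIn A X
colIndep-or-cycle A X with colIndep? A X in indep
... | true  = inj₁ (colIndep?-sound A X indep)
... | false = inj₂ (colIndep?-false A X indep)

colIndep?-complete : (A : Matrix r n) (X : Sub n) → ColIndep A X → colIndep? A X ≡ true
colIndep?-complete A X acyclic with colIndep? A X in indep
... | true  = refl
... | false with colIndep?-false A X indep
... | W , W⊆X , cyc , i , Wi with () ← trans (sym Wi) (acyclic W W⊆X cyc i)

IsCircuit : Matroid n → Sub n → Set
IsCircuit M C = ¬ Indep M C × (∀ Y x → Y ⊆ C → C x ≡ true → Y x ≡ false → Indep M Y)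

circuit-isCycle : (A : Matrix r n) {C : Sub n} → IsCircuit (columnMatroid A) C → IsCycle A C
circuit-isCycle A {C} (dependent , minimal) with colIndep-or-cycle A C
... | inj₁ indep = ⊥-elim (dependent indep)
... | inj₂ (W , W⊆C , cyc , i , Wi) = IsCycle-cong A W≗C cyc
  where
  W≗C : W ≗ C
  W≗C x with W x in Wx | C x in Cx
  ... | true  | true  = refl
  ... | false | false = refl
  ... | true  | false = ⊥-elim (true≢false (W⊆C x Wx) Cx)
  ... | false | true  = ⊥-elim (true≢false Wi (minimal W x W⊆C Cx Wx W ⊆-refl cyc i))

module _ {Cyc : Sub n → Set} (Cyc-cong : Extensional Cyc)
         (Cyc-⊕ : ∀ {X Y} → Cyc X → Cyc Y → Cyc (X ⊕ Y)) where

  cycle⇔span-fixed : (span : Sub n → Sub n) {B : Sub n} → Acyclic Cyc B →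
                     (∀ Z → Cyc (span Z)) → (∀ Z → Z ⊕ span Z ⊆ B) →
                     ∀ Y → Cyc Y ⇔ Y ≗ span Y
  cycle⇔span-fixed span acyclic span-cycle residual Y = mk⇔
    (λ cycY i → xor≡false⇒≡ (acyclic (Y ⊕ span Y) (residual Y) (Cyc-⊕ cycY (span-cycle Y)) i))
    (λ Y≗ → Cyc-cong (λ i → sym (Y≗ i)) (span-cycle Y))

-- Bases and the dual of a column matroid

isBasis? : Matrix r n → Sub n → Bool
isBasis? A B = colIndep? A B ∧ allFin (λ i → B i ∨ not (colIndep? A (B ∪｛ i ｝)))

∪｛｝-⊇ : (B : Sub n) (i : Fin n) → B ⊆ B ∪｛ i ｝
∪｛｝-⊇ B i j Bj rewrite Bj = refl

∪｛｝-∋ : (B : Sub n) (i : Fin n) → (B ∪｛ i ｝) i ≡ true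
∪｛｝-∋ B i rewrite ≟-refl i with B i
... | false = refl
... | true  = refl

∪｛｝-⊆ : {B Y : Sub n} {i : Fin n} → B ⊆ Y → Y i ≡ true → B ∪｛ i ｝ ⊆ Y
∪｛｝-⊆ {B = B} {Y} {i} B⊆Y Yi j p with ∨-true {B j} p
... | inj₁ Bj = B⊆Y j Bj
... | inj₂ i≡j = subst (λ k → Y k ≡ true) (≟-sound i≡j) Yi

∪｛｝-cong : {X Y : Sub n} → X ≗ Y → ∀ i → X ∪｛ i ｝ ≗ Y ∪｛ i ｝
∪｛｝-cong X≗Y i j = cong (_∨ ⌊ i ≟ j ⌋) (X≗Y j)

isBasis?-sound : (A : Matrix r n) (B : Sub n) → isBasis? A B ≡ true → IsBasis (columnMatroid A) B
isBasis?-sound A B basis = (λ _ _ → refl) , colIndep?-sound A B indep , maximal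
  where
  indep : colIndep? A B ≡ true
  indep = proj₁ (∧-true basis)
  saturated : ∀ i → B i ∨ not (colIndep? A (B ∪｛ i ｝)) ≡ true
  saturated = allFin-sound _ (proj₂ (∧-true {colIndep? A B} basis))
  maximal : ∀ Y → B ⊆ Y → Y ⊆ (λ _ → true) → ColIndep A Y → Y ⊆ B
  maximal Y B⊆Y _ indepY i Yi with ∨-true (saturated i)
  ... | inj₁ Bi = Bi
  ... | inj₂ dep with () ← trans (sym (not-true dep))
                         (colIndep?-complete A _ (Acyclic-mono (∪｛｝-⊆ B⊆Y Yi) indepY))

isBasis?-complete : (A : Matrix r n) (B : Sub n) → IsBasis (columnMatroid A) B → isBasis? A B ≡ true
isBasis?-complete A B (_ , indep , maximal) =
  cong₂ _∧_ (colIndep?-complete A B indep) (allFin-complete _ saturated)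
  where
  saturated : ∀ i → B i ∨ not (colIndep? A (B ∪｛ i ｝)) ≡ true
  saturated i with B i in Bi | colIndep? A (B ∪｛ i ｝) in indepBi
  ... | true  | _     = refl
  ... | false | false = refl
  ... | false | true  with () ← trans (sym Bi)
        (maximal _ (∪｛｝-⊇ B i) (λ _ _ → refl) (colIndep?-sound A _ indepBi) i (∪｛｝-∋ B i))

isBasis?-cong : (A : Matrix r n) → Extensionalᵇ (isBasis? A)
isBasis?-cong A X≗Y = cong₂ _∧_ (colIndep?-cong A X≗Y)
  (allFin-cong (λ i → cong₂ (λ b c → b ∨ not c) (X≗Y i) (colIndep?-cong A (∪｛｝-cong X≗Y i))))

*-mono : (M : Matroid n) {X Y : Sub n} → Y ⊆ X → Indep (M *) X → Indep (M *) Y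
*-mono M Y⊆X (B , basis , avoids) = B , basis , λ i Yi → avoids i (Y⊆X i Yi)

disjoint? : Sub n → Sub n → Bool
disjoint? Z B = allFin (λ i → not (Z i ∧ B i))

disjoint?-sound : {Z B : Sub n} → disjoint? Z B ≡ true → ∀ i → Z i ≡ true → B i ≡ false
disjoint?-sound {Z = Z} {B} disj i Zi with allFin-sound _ disj i
... | avoid rewrite Zi = not-true avoid

disjoint?-complete : {Z B : Sub n} → (∀ i → Z i ≡ true → B i ≡ false) → disjoint? Z B ≡ true
disjoint?-complete {Z = Z} {B} avoids = allFin-complete _ pointwise
  where
  pointwise : ∀ i → not (Z i ∧ B i) ≡ true
  pointwise i with Z i in Zi
  ... | false = refl
  ... | true  rewrite avoids i Zi = refl

avoidingBasis? : Matrix r n → Sub n → Sub n → Bool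
avoidingBasis? A Z B = isBasis? A B ∧ disjoint? Z B

avoidingBasis?-cong : (A : Matrix r n) (Z : Sub n) → Extensionalᵇ (avoidingBasis? A Z)
avoidingBasis?-cong A Z X≗Y =
  cong₂ _∧_ (isBasis?-cong A X≗Y) (allFin-cong (λ i → cong (λ b → not (Z i ∧ b)) (X≗Y i)))

dualIndep? : Matrix r n → Sub n → Bool
dualIndep? A Z = not (allSub (λ B → not (avoidingBasis? A Z B)))

dualIndep?-sound : (A : Matrix r n) (Z : Sub n) → dualIndep? A Z ≡ true → Indep (columnMatroid A *) Z
dualIndep?-sound A Z indep with allSub-false _ (not-true indep)
... | B , found with ∧-true (not-false found)
... | basis , disj = B , isBasis?-sound A B basis , disjoint?-sound disj

dualIndep?-complete : (A : Matrix r n) (Z : Sub n) → Indep (columnMatroid A *) Z → dualIndep? A Z ≡ true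
dualIndep?-complete A Z (B , basis , avoids) with allSub (λ B → not (avoidingBasis? A Z B)) in none
... | false = refl
... | true  with () ← trans (sym (allSub-sound _ (cong not ∘ avoidingBasis?-cong A Z) none B))
                          (cong₂ (λ b d → not (b ∧ d)) (isBasis?-complete A B basis)
                                                        (disjoint?-complete avoids))

─-⊇ : {Y C : Sub n} {x : Fin n} → Y ⊆ C → Y x ≡ false → Y ⊆ C ─ x
─-⊇ {Y = Y} {C} {x} Y⊆C Yx i Yi
  rewrite Y⊆C i Yi | ≟-≢ {i = x} {i} (λ { refl → true≢false Yi Yx }) = refl

isDualCircuit? : Matrix r n → Sub n → Bool
isDualCircuit? A C = not (dualIndep? A C) ∧ allFin (λ x → not (C x) ∨ dualIndep? A (C ─ x))

isDualCircuit?-sound : (A : Matrix r n) (C : Sub n) → isDualCircuit? A C ≡ true →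
                       IsCircuit (columnMatroid A *) C
isDualCircuit?-sound A C circuit with ∧-true circuit
... | dependent , minimal = indep⇒⊥ , λ Y x Y⊆C Cx Yx → *-mono (columnMatroid A) (─-⊇ Y⊆C Yx)
      (dualIndep?-sound A (C ─ x) (or-true (∨-true (allFin-sound _ minimal x)) Cx))
  where
  indep⇒⊥ : ¬ Indep (columnMatroid A *) C
  indep⇒⊥ indep with () ← trans (sym (not-true dependent)) (dualIndep?-complete A C indep)
  or-true : ∀ {c d} → not c ≡ true ⊎ d ≡ true → c ≡ true → d ≡ true
  or-true (inj₂ d) _ = d
  or-true (inj₁ nc) c with () ← trans (sym (not-true nc)) c

-- Extending a subset of the ground set of N ∖ a to that of N

module _ (a : Fin (suc n)) where

  liftAt-at : ∀ b (Y : Sub n) → liftAt a b Y a ≡ b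
  liftAt-at b Y with a ≟ a
  ... | yes _   = refl
  ... | no a≢a = ⊥-elim (a≢a refl)

  liftAt-punchIn : ∀ b (Y : Sub n) i → liftAt a b Y (punchIn a i) ≡ Y i
  liftAt-punchIn b Y i with a ≟ punchIn a i
  ... | yes a≡ = ⊥-elim (punchInᵢ≢i a i (sym a≡))
  ... | no _   = cong Y (trans (punchOut-cong a refl) (punchOut-punchIn a))

  liftAt-η : (W : Sub (suc n)) → W ≗ liftAt a (W a) (W ∘ punchIn a)
  liftAt-η W j with a ≟ j
  ... | yes refl = refl
  ... | no a≢j   = cong W (sym (punchIn-punchOut a≢j))

  liftAt-η-at : ∀ (W : Sub (suc n)) {b} → W a ≡ b → W ≗ liftAt a b (W ∘ punchIn a)
  liftAt-η-at W Wa j = trans (liftAt-η W j) (cong (λ b → liftAt a b (W ∘ punchIn a) j) Wa)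

  liftAt-cong : ∀ b {Y Z : Sub n} → Y ≗ Z → liftAt a b Y ≗ liftAt a b Z
  liftAt-cong b Y≗Z j with a ≟ j
  ... | yes _   = refl
  ... | no a≢j = Y≗Z (punchOut a≢j)

  liftAt-⊕ : ∀ b c (Y Z : Sub n) → liftAt a b Y ⊕ liftAt a c Z ≗ liftAt a (b xor c) (Y ⊕ Z)
  liftAt-⊕ b c Y Z j with a ≟ j
  ... | yes _ = refl
  ... | no _  = refl

  liftAt-mono : ∀ {b c} {Y Z : Sub n} → (b ≡ true → c ≡ true) → Y ⊆ Z → liftAt a b Y ⊆ liftAt a c Z
  liftAt-mono b⇒c Y⊆Z j with a ≟ j
  ... | yes _   = b⇒c
  ... | no a≢j = Y⊆Z (punchOut a≢j)

  ⊆-liftAt : ∀ {b} {X : Sub n} {W : Sub (suc n)} → W ⊆ liftAt a b X → (W ∘ punchIn a) ⊆ X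
  ⊆-liftAt {b} {X} {W} W⊆ i Wi = trans (sym (liftAt-punchIn b X i)) (W⊆ (punchIn a i) Wi)

  ⊆-liftAt-false : ∀ {X : Sub n} {W : Sub (suc n)} → W ⊆ liftAt a false X → W a ≡ false
  ⊆-liftAt-false {X} {W} W⊆ with W a in Wa
  ... | false = refl
  ... | true  = ⊥-elim (true≢false (W⊆ a Wa) (liftAt-at false X))

  IsEmpty-liftAt : ∀ {b} {Y : Sub n} → IsEmpty (liftAt a b Y) → IsEmpty Y
  IsEmpty-liftAt {b} {Y} empty i = trans (sym (liftAt-punchIn b Y i)) (empty (punchIn a i))

  liftAt-false-IsEmpty : ∀ {Y : Sub n} → IsEmpty Y → IsEmpty (liftAt a false Y)
  liftAt-false-IsEmpty empty j with a ≟ j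
  ... | yes _   = refl
  ... | no a≢j = empty (punchOut a≢j)

  ⁅⁆-liftAt : ⁅ a ⁆ ≗ liftAt a true ∅
  ⁅⁆-liftAt j with a ≟ j
  ... | yes _ = refl
  ... | no _  = refl

  liftAt-false-∋ : ∀ {Y : Sub n} x → liftAt a false Y x ≡ true →
                   ∃ λ p → x ≡ punchIn a p × Y p ≡ true
  liftAt-false-∋ x Yx with a ≟ x
  ... | no a≢x = punchOut a≢x , sym (punchIn-punchOut a≢x) , Yx

  ⊆⁅⁆-nonempty : ∀ {W : Sub (suc n)} {i} → W ⊆ ⁅ a ⁆ → W i ≡ true → W ≗ ⁅ a ⁆
  ⊆⁅⁆-nonempty {W} {i} W⊆ Wi j with W j in Wj | a ≟ j
  ... | true  | yes _   = refl
  ... | false | no _    = refl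
  ... | true  | no a≢j  = ⊥-elim (a≢j (≟-sound (W⊆ j Wj)))
  ... | false | yes refl =
    ⊥-elim (true≢false (subst (λ k → W k ≡ true) (sym (≟-sound (W⊆ i Wi))) Wi) Wj)

-- Deletion and contraction of one element of a binary matroid

module Contraction (N : Matroid (suc n)) (a : Fin (suc n)) (A : Matrix r (suc n))
                   (N≈A : ∀ X → Indep N X ⇔ ColIndep A X) where

  private
    toA : ∀ {X} → Indep N X → ColIndep A X
    toA = Equivalence.to (N≈A _)
    fromA : ∀ {X} → ColIndep A X → Indep N X
    fromA = Equivalence.from (N≈A _)

  Cycle∖a : Sub n → Set
  Cycle∖a Y = IsCycle A (liftAt a false Y)

  Cycle∖a-cong : Extensional Cycle∖a
  Cycle∖a-cong Y≗Z = IsCycle-cong A (liftAt-cong a false Y≗Z)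

  Cycle∖a-⊕ : ∀ {Y Z} → Cycle∖a Y → Cycle∖a Z → Cycle∖a (Y ⊕ Z)
  Cycle∖a-⊕ {Y} {Z} cycY cycZ =
    IsCycle-cong A (liftAt-⊕ a false false Y Z)
                   (IsCycle-⊕ A {liftAt a false Y} {liftAt a false Z} cycY cycZ)

  Cycle∖a-· : ∀ b {C} → Cycle∖a C → Cycle∖a (b · C)
  Cycle∖a-· false _   = IsCycle-cong A (λ j → sym (liftAt-false-IsEmpty a (λ _ → refl) j)) (IsCycle-∅ A)
  Cycle∖a-· true  cyc = cyc

  deletion-acyclic : ∀ {X} → Indep (N ∖ a) X → Acyclic Cycle∖a X
  deletion-acyclic indep Y Y⊆X cyc =
    IsEmpty-liftAt a (toA indep (liftAt a false Y) (liftAt-mono a (λ ()) Y⊆X) cyc)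

  deletion-circuit : ∀ {C} → IsCircuit (N ∖ a) C → Cycle∖a C
  deletion-circuit {C} (dependent , minimal) = circuit-isCycle A (dependent ∘ fromA , minimalA)
    where
    minimalA : ∀ W x → W ⊆ liftAt a false C → liftAt a false C x ≡ true → W x ≡ false → ColIndep A W
    minimalA W x W⊆ Cx Wx with liftAt-false-∋ a x Cx
    ... | p , refl , Cp = Acyclic-mono (≗-⊆ (liftAt-η-at a W (⊆-liftAt-false a W⊆)) ⊆-refl)
        (toA (minimal (W ∘ punchIn a) p (⊆-liftAt a W⊆) Cp Wx))

  loop-or-nonloop : IsCycle A ⁅ a ⁆ ⊎ ColIndep A ⁅ a ⁆
  loop-or-nonloop with colIndep-or-cycle A ⁅ a ⁆
  ... | inj₁ indep = inj₂ indep
  ... | inj₂ (W , W⊆ , cyc , i , Wi) = inj₁ (IsCycle-cong A (⊆⁅⁆-nonempty a W⊆ Wi) cyc)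

  loop-nonloop : IsCycle A ⁅ a ⁆ → ¬ ColIndep A ⁅ a ⁆
  loop-nonloop loop nonloop = true≢false (≟-refl a) (nonloop ⁅ a ⁆ ⊆-refl loop a)

  loop-by-cycles : ∀ {W₀} → IsCycle A (liftAt a true W₀) → Cycle∖a W₀ → IsCycle A ⁅ a ⁆
  loop-by-cycles {W₀} through avoiding = IsCycle-cong A
    (λ j → trans (liftAt-⊕ a true false W₀ W₀ j)
                 (trans (liftAt-cong a true (λ i → xor-same (W₀ i)) j) (sym (⁅⁆-liftAt a j))))
    (IsCycle-⊕ A {liftAt a true W₀} {liftAt a false W₀} through avoiding)

  contract-nonloop : ColIndep A ⁅ a ⁆ → ∀ X → Indep (N / a) X ⇔ ColIndep A (liftAt a true X)
  contract-nonloop nonloop X = mk⇔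
    (λ { (B , (B⊆ , _ , maximal) , indep) →
         Acyclic-mono (lift⊆ (maximal ⁅ a ⁆ B⊆ ⊆-refl (fromA nonloop) a (≟-refl a))) (toA indep) })
    (λ indep → ⁅ a ⁆ , (⊆-refl , fromA nonloop , (λ _ _ Y⊆ _ → Y⊆)) ,
               fromA (Acyclic-mono ⊆lift indep))
    where
    lift⊆ : ∀ {B} → B a ≡ true → liftAt a true X ⊆ (liftAt a false X ∪ B)
    lift⊆ Ba j Xj with a ≟ j
    ... | yes refl = Ba
    ... | no _ rewrite Xj = refl
    ⊆lift : (liftAt a false X ∪ ⁅ a ⁆) ⊆ liftAt a true X
    ⊆lift j p with a ≟ j
    ... | yes _ = refl
    ... | no a≢j with X (punchOut a≢j) | p
    ...   | true | _ = refl

  contract-loop : IsCycle A ⁅ a ⁆ → ∀ X → Indep (N / a) X ⇔ Indep (N ∖ a) X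
  contract-loop loop X = mk⇔
    (λ { (_ , _ , indep) → fromA (Acyclic-mono (λ j Xj → cong (_∨ _) Xj) (toA indep)) })
    (λ indep → ∅ , ((λ _ ()) , fromA ∅-indep , maximal) , fromA (Acyclic-mono ∪∅⊆ (toA indep)))
    where
    ∅-indep : ColIndep A ∅
    ∅-indep W W⊆∅ _ i with W i in Wi
    ... | false = refl
    ... | true  with () ← W⊆∅ i Wi
    maximal : ∀ Y → ∅ ⊆ Y → Y ⊆ ⁅ a ⁆ → Indep N Y → Y ⊆ ∅
    maximal Y _ Y⊆ indepY i Yi =
      ⊥-elim (loop-nonloop loop
        (Acyclic-mono (≗-⊆ (λ j → sym (⊆⁅⁆-nonempty a Y⊆ Yi j)) ⊆-refl) (toA indepY)))
    ∪∅⊆ : (liftAt a false X ∪ ∅) ⊆ liftAt a false X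
    ∪∅⊆ j p with liftAt a false X j | p
    ... | true | _ = refl

  contract-coloop : (∀ Y → ¬ IsCycle A (liftAt a true Y)) → ∀ X → Indep (N / a) X ⇔ Indep (N ∖ a) X
  contract-coloop coloop X = ⇔-trans (contract-nonloop nonloop X)
    (mk⇔ (λ indep → fromA (Acyclic-mono (liftAt-mono a (λ ()) ⊆-refl) indep)) (through-a-free ∘ toA))
    where
    nonloop : ColIndep A ⁅ a ⁆
    nonloop W W⊆ cyc i with W i in Wi
    ... | false = refl
    ... | true  =
      ⊥-elim (coloop ∅ (IsCycle-cong A (λ j → trans (⊆⁅⁆-nonempty a W⊆ Wi j) (⁅⁆-liftAt a j)) cyc))
    through-a-free : ColIndep A (liftAt a false X) → ColIndep A (liftAt a true X)
    through-a-free indep W W⊆ cyc with W a in Wa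
    ... | true  = ⊥-elim (coloop (W ∘ punchIn a) (IsCycle-cong A (liftAt-η-at a W Wa) cyc))
    ... | false = indep W (≗-⊆ (liftAt-η-at a W Wa) (liftAt-mono a (λ ()) (⊆-liftAt a W⊆))) cyc

  contract-acyclic : ColIndep A ⁅ a ⁆ → ∀ {W₀} → IsCycle A (liftAt a true W₀) →
                     ∀ X → Indep (N / a) X ⇔ Acyclic (λ Y → Cycle∖a Y ⊎ Cycle∖a (Y ⊕ W₀)) X
  contract-acyclic nonloop {W₀} cycW₀ X = ⇔-trans (contract-nonloop nonloop X) (mk⇔ forward backward)
    where
    forward : ColIndep A (liftAt a true X) → Acyclic (λ Y → Cycle∖a Y ⊎ Cycle∖a (Y ⊕ W₀)) X
    forward indep Y Y⊆X (inj₁ cyc) = IsEmpty-liftAt a (indep _ (liftAt-mono a (λ _ → refl) Y⊆X) cyc)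
    forward indep Y Y⊆X (inj₂ cyc) = ⊥-elim (true≢false (liftAt-at a true Y)
      (indep _ (liftAt-mono a id Y⊆X) through-a a))
      where
      through-a : IsCycle A (liftAt a true Y)
      through-a = IsCycle-cong A
        (λ j → trans (liftAt-⊕ a false true (Y ⊕ W₀) W₀ j) (liftAt-cong a true (⊕-cancelʳ Y W₀) j))
                    (IsCycle-⊕ A {liftAt a false (Y ⊕ W₀)} {liftAt a true W₀} cyc cycW₀)
    backward : Acyclic (λ Y → Cycle∖a Y ⊎ Cycle∖a (Y ⊕ W₀)) X → ColIndep A (liftAt a true X)
    backward acyclic W W⊆ cyc with W a in Wa
    ... | false = λ j → trans (liftAt-η-at a W Wa j)
        (liftAt-false-IsEmpty a (acyclic _ (⊆-liftAt a W⊆) (inj₁ (IsCycle-cong A (liftAt-η-at a W Wa) cyc))) j)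
    ... | true  = ⊥-elim (loop-nonloop loop nonloop)
      where
      W′ : Sub n
      W′ = W ∘ punchIn a
      cycW′ : IsCycle A (liftAt a true W′)
      cycW′ = IsCycle-cong A (liftAt-η-at a W Wa) cyc
      W′-empty : IsEmpty W′
      W′-empty = acyclic W′ (⊆-liftAt a W⊆) (inj₂ (IsCycle-cong A (liftAt-⊕ a true true W′ W₀)
                   (IsCycle-⊕ A {liftAt a true W′} {liftAt a true W₀} cycW′ cycW₀)))
      loop : IsCycle A ⁅ a ⁆
      loop = IsCycle-cong A (λ j → trans (liftAt-cong a true W′-empty j) (sym (⁅⁆-liftAt a j))) cycW′

-- Transport along a bijection of ground sets

module _ {m n : ℕ} (σ : Fin n ↔ Fin m) where

  open Inverse σ using (to; from; strictlyInverseˡ; strictlyInverseʳ)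

  from-injective : Injective _≡_ _≡_ from
  from-injective {x} {y} fx≡fy =
    trans (sym (strictlyInverseˡ x)) (trans (cong to fx≡fy) (strictlyInverseˡ y))

  to-injective : Injective _≡_ _≡_ to
  to-injective {x} {y} tx≡ty =
    trans (sym (strictlyInverseʳ x)) (trans (cong from tx≡ty) (strictlyInverseʳ y))

  Acyclic-relabel : {C : Sub n → Set} {D : Sub m → Set} → Extensional D →
                    (∀ Y → C Y ⇔ D (Y ∘ from)) → ∀ X → Acyclic C X ⇔ Acyclic D (X ∘ from)
  Acyclic-relabel {C} {D} D-ext C⇔D X = mk⇔ forward backward
    where
    forward : Acyclic C X → Acyclic D (X ∘ from)
    forward acyclic Z Z⊆ dZ k = trans (cong Z (sym (strictlyInverseˡ k)))
      (acyclic (Z ∘ to) Y⊆X (Equivalence.from (C⇔D (Z ∘ to)) (D-ext (cong Z ∘ sym ∘ strictlyInverseˡ) dZ))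
               (from k))
      where
      Y⊆X : (Z ∘ to) ⊆ X
      Y⊆X j Zj = subst (λ i → X i ≡ true) (strictlyInverseʳ j) (Z⊆ (to j) Zj)
    backward : Acyclic D (X ∘ from) → Acyclic C X
    backward acyclic Y Y⊆X cY j = trans (cong Y (sym (strictlyInverseʳ j)))
      (acyclic (Y ∘ from) (λ k → Y⊆X (from k)) (Equivalence.to (C⇔D Y) cY) (to j))

  ∘from-img : (X : Sub m) → img from X ∘ from ≗ X
  ∘from-img X p with X p in Xp
  ... | true  = anyFin-complete (λ i → X i ∧ ⌊ from i ≟ from p ⌋) p
                                (subst (λ b → b ∧ _ ≡ true) (sym Xp) (≟-refl (from p)))
  ... | false with anyFin (λ i → X i ∧ ⌊ from i ≟ from p ⌋) in hit
  ...   | false = refl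
  ...   | true  with anyFin-sound (λ i → X i ∧ ⌊ from i ≟ from p ⌋) hit
  ...     | i , Xi∧ with ∧-true Xi∧
  ...       | Xi , fi≡fp =
    ⊥-elim (true≢false (subst (λ k → X k ≡ true) (from-injective (≟-sound fi≡fp)) Xi) Xp)

≅⇒HasMinor : {m n : ℕ} {M : Matroid n} {F : Matroid m} →
             Extensional (Indep F) → Indep F ∅ → M ≅ F → HasMinor M F
≅⇒HasMinor {M = M} {F} F-ext F∅ (σ , M≅F) =
  ∅ , ∅ , (⊆-refl , Equivalence.from (M≅F ∅) F∅ , (λ _ _ Y⊆ _ → Y⊆)) ,
  from , from-injective σ , (λ _ → refl) , λ X →
    mk⇔ (λ FX → Equivalence.from (M≅F _) (F-ext (λ p → sym (img∪∅ X p)) FX))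
        (λ MX → F-ext (img∪∅ X) (Equivalence.to (M≅F _) MX))
  where
  open Inverse σ using (from)
  img∪∅ : ∀ X → (img from X ∪ ∅) ∘ from ≗ X
  img∪∅ X p = trans (∨-identityʳ _) (∘from-img σ X p)

≅⇒IsGraphic : {m n v : ℕ} {M : Matroid n} {ends : Fin m → Fin v × Fin v} →
              M ≅ cycleMatroid ends → IsGraphic M
≅⇒IsGraphic {v = v} {ends = ends} (σ , M≅G) = v , ends ∘ to , λ X →
  ⇔-trans (M≅G X) (mk⇔ (λ acyclic → acyclic ∘ backward X) (λ acyclic → acyclic ∘ forward X))
  where
  open Inverse σ using (to; from; strictlyInverseˡ; strictlyInverseʳ)
  forward : ∀ X → HasCycleIn ends (X ∘ from) → HasCycleIn (ends ∘ to) X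
  forward X (k , vs , es , vs-inj , es-inj , inX , joins) =
    k , vs , from ∘ es , vs-inj , es-inj ∘ from-injective σ , inX ,
    λ i → subst (λ e → Joins ends e (vs i) (vs (next i))) (sym (strictlyInverseˡ (es i))) (joins i)
  backward : ∀ X → HasCycleIn (ends ∘ to) X → HasCycleIn ends (X ∘ from)
  backward X (k , vs , es , vs-inj , es-inj , inX , joins) =
    k , vs , to ∘ es , vs-inj , es-inj ∘ to-injective σ ,
    (λ i → subst (λ e → X e ≡ true) (sym (strictlyInverseʳ (es i))) (inX i)) , joins

IsCircuit-≅ : {m n : ℕ} {M : Matroid n} {F : Matroid m} → Extensional (Indep F) →
              ((σ , _) : M ≅ F) → ∀ {C} → IsCircuit F C → IsCircuit M (C ∘ Inverse.to σ)
IsCircuit-≅ {M = M} {F} F-ext (σ , M≅F) {C} (dependent , minimal) =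
  (λ indep → dependent (F-ext (λ k → cong C (strictlyInverseˡ k)) (Equivalence.to (M≅F _) indep))) ,
  λ Y x Y⊆ Cx Yx → Equivalence.from (M≅F Y)
    (minimal (Y ∘ from) (to x) (λ k Yk → subst (λ i → C i ≡ true) (strictlyInverseˡ k) (Y⊆ (from k) Yk)) Cx
             (trans (cong Y (strictlyInverseʳ x)) Yx))
  where
  open Inverse σ using (to; from; strictlyInverseˡ; strictlyInverseʳ)

-- Cycle matroids of graphs

next-inject₁ : (i : Fin k) → next (inject₁ i) ≡ suc i
next-inject₁ {k} i with suc (toℕ (inject₁ i)) <? suc k
... | yes p = toℕ-injective (trans (toℕ-fromℕ< p) (cong suc (toℕ-inject₁ i)))
... | no ¬p = ⊥-elim (¬p (s≤s (subst (λ t → suc t ≤ k) (sym (toℕ-inject₁ i)) (toℕ<n i))))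

next-fromℕ : ∀ k → next (fromℕ k) ≡ zero
next-fromℕ k with suc (toℕ (fromℕ k)) <? suc k
... | yes p = ⊥-elim (n≮n (suc k) (subst (λ t → suc t < suc k) (toℕ-fromℕ k) p))
... | no _  = refl

xorSum-fromℕ : (g : Fin (suc k) → Bool) → xorSum g ≡ xorSum (g ∘ inject₁) xor g (fromℕ k)
xorSum-fromℕ {zero}  g = xor-identityʳ (g zero)
xorSum-fromℕ {suc k} g =
  trans (cong (g zero xor_) (xorSum-fromℕ (g ∘ suc))) (sym (xor-assoc (g zero) _ _))

xorSum-next : (g : Fin (suc k) → Bool) → xorSum (g ∘ next) ≡ xorSum g
xorSum-next {k} g = begin
  xorSum (g ∘ next)                                  ≡⟨ xorSum-fromℕ (g ∘ next) ⟩
  xorSum (g ∘ next ∘ inject₁) xor g (next (fromℕ k))  ≡⟨ cong₂ _xor_ (xorSum-cong (cong g ∘ next-inject₁))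
                                                                    (cong g (next-fromℕ k)) ⟩
  xorSum (g ∘ suc) xor g zero                        ≡⟨ xor-comm _ (g zero) ⟩
  xorSum g                                           ∎

incidence : (Fin n → Fin v × Fin v) → Matrix v n
incidence ends w e = ⌊ proj₁ (ends e) ≟ w ⌋ xor ⌊ proj₂ (ends e) ≟ w ⌋

incidence-Joins : (ends : Fin n → Fin v × Fin v) {e : Fin n} {x y : Fin v} (w : Fin v) →
                  Joins ends e x y → incidence ends w e ≡ ⌊ x ≟ w ⌋ xor ⌊ y ≟ w ⌋
incidence-Joins ends w (inj₁ e≡) rewrite e≡ = refl
incidence-Joins ends {x = x} {y} w (inj₂ e≡) rewrite e≡ = xor-comm ⌊ y ≟ w ⌋ ⌊ x ≟ w ⌋

edgeSet : (Fin m → Fin n) → Sub n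
edgeSet es e = anyFin (λ i → ⌊ es i ≟ e ⌋)

edgeSet-∋ : (es : Fin m → Fin n) (i : Fin m) → edgeSet es (es i) ≡ true
edgeSet-∋ es i = anyFin-complete _ i (≟-refl (es i))

edgeSet-⊆ : (es : Fin m → Fin n) {X : Sub n} → (∀ i → X (es i) ≡ true) → edgeSet es ⊆ X
edgeSet-⊆ es {X} inX e hit with anyFin-sound _ hit
... | i , es≡ = subst (λ f → X f ≡ true) (≟-sound es≡) (inX i)

xorSum-edgeSet : (es : Fin m → Fin n) → Injective _≡_ _≡_ es → (h : Fin n → Bool) →
                 xorSum (λ e → edgeSet es e ∧ h e) ≡ xorSum (h ∘ es)
xorSum-edgeSet {zero}  {n} es inj h = xorSum-false {n} _ (λ _ → refl)
xorSum-edgeSet {suc m} es inj h = begin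
  xorSum (λ e → edgeSet es e ∧ h e)
    ≡⟨ xorSum-cong (λ e → trans (cong (_∧ h e) (∨⇒xor e))
                                (∧-distribʳ-xor (h e) ⌊ es zero ≟ e ⌋ (edgeSet (es ∘ suc) e))) ⟩
  xorSum (λ e → (⌊ es zero ≟ e ⌋ ∧ h e) xor (edgeSet (es ∘ suc) e ∧ h e))
    ≡⟨ xorSum-xor (λ e → ⌊ es zero ≟ e ⌋ ∧ h e) (λ e → edgeSet (es ∘ suc) e ∧ h e) ⟩
  xorSum (λ e → ⌊ es zero ≟ e ⌋ ∧ h e) xor xorSum (λ e → edgeSet (es ∘ suc) e ∧ h e)
    ≡⟨ cong₂ _xor_ (xorSum-indicator (es zero) h) (xorSum-edgeSet (es ∘ suc) (suc-injective ∘ inj) h) ⟩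
  xorSum (h ∘ es) ∎
  where
  ∨⇒xor : ∀ e → edgeSet es e ≡ ⌊ es zero ≟ e ⌋ xor edgeSet (es ∘ suc) e
  ∨⇒xor e with ⌊ es zero ≟ e ⌋ in hit₀ | edgeSet (es ∘ suc) e in hit
  ... | false | _     = refl
  ... | true  | false = refl
  ... | true  | true  with anyFin-sound (λ i → ⌊ es (suc i) ≟ e ⌋) hit
  ...   | i , es≡ with () ← inj (trans (≟-sound hit₀) (sym (≟-sound es≡)))

cycleEdges-isCycle : (ends : Fin n → Fin v × Fin v) {vs : Fin (suc k) → Fin v} {es : Fin (suc k) → Fin n} →
                     Injective _≡_ _≡_ es → (∀ i → Joins ends (es i) (vs i) (vs (next i))) →
                     IsCycle (incidence ends) (edgeSet es)
cycleEdges-isCycle ends {vs} {es} es-inj joins w = begin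
  xorSum (λ e → edgeSet es e ∧ incidence ends w e)         ≡⟨ xorSum-edgeSet es es-inj (incidence ends w) ⟩
  xorSum (λ i → incidence ends w (es i))                   ≡⟨ xorSum-cong (λ i → incidence-Joins ends w (joins i)) ⟩
  xorSum (λ i → ⌊ vs i ≟ w ⌋ xor ⌊ vs (next i) ≟ w ⌋)       ≡⟨ xorSum-xor (λ i → ⌊ vs i ≟ w ⌋) (λ i → ⌊ vs (next i) ≟ w ⌋) ⟩
  xorSum (λ i → ⌊ vs i ≟ w ⌋) xor xorSum (λ i → ⌊ vs (next i) ≟ w ⌋)
                                                           ≡⟨ cong (xorSum (λ i → ⌊ vs i ≟ w ⌋) xor_) (xorSum-next (λ i → ⌊ vs i ≟ w ⌋)) ⟩
  xorSum (λ i → ⌊ vs i ≟ w ⌋) xor xorSum (λ i → ⌊ vs i ≟ w ⌋) ≡⟨ xor-same (xorSum (λ i → ⌊ vs i ≟ w ⌋)) ⟩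
  false                                                    ∎

HasCycleIn-mono : (ends : Fin n → Fin v × Fin v) {X Y : Sub n} → X ⊆ Y → HasCycleIn ends X → HasCycleIn ends Y
HasCycleIn-mono ends X⊆Y (k , vs , es , vs-inj , es-inj , inX , joins) =
  k , vs , es , vs-inj , es-inj , (λ i → X⊆Y _ (inX i)) , joins

data Polygon (n v : ℕ) : Set where
  polygon : Vec (Fin v) (suc k) → Vec (Fin n) (suc k) → Polygon n v

polygonEdges : Polygon n v → Sub n
polygonEdges (polygon _ es) = edgeSet (lookup es)

injective? : (Fin m → Fin n) → Bool
injective? f = allFin (λ i → allFin (λ j → ⌊ i ≟ j ⌋ ∨ not ⌊ f i ≟ f j ⌋))

injective?-sound : (f : Fin m → Fin n) → injective? f ≡ true → Injective _≡_ _≡_ f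
injective?-sound f inj {i} {j} fi≡fj
  with ∨-true (allFin-sound (λ j → ⌊ i ≟ j ⌋ ∨ not ⌊ f i ≟ f j ⌋)
                (allFin-sound (λ i → allFin (λ j → ⌊ i ≟ j ⌋ ∨ not ⌊ f i ≟ f j ⌋)) inj i) j)
... | inj₁ i≡j = ≟-sound i≡j
... | inj₂ fi≢fj =
  ⊥-elim (true≢false (≟-refl (f i)) (subst (λ x → ⌊ f i ≟ x ⌋ ≡ false) (sym fi≡fj) (not-true fi≢fj)))

joins? : (Fin n → Fin v × Fin v) → Fin n → Fin v → Fin v → Bool
joins? ends e x y = (⌊ proj₁ (ends e) ≟ x ⌋ ∧ ⌊ proj₂ (ends e) ≟ y ⌋)
                  ∨ (⌊ proj₁ (ends e) ≟ y ⌋ ∧ ⌊ proj₂ (ends e) ≟ x ⌋)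

joins?-sound : (ends : Fin n → Fin v × Fin v) {e : Fin n} {x y : Fin v} →
               joins? ends e x y ≡ true → Joins ends e x y
joins?-sound ends {e} joins with ∨-true joins
... | inj₁ p = let p₁ , p₂ = ∧-true p in inj₁ (cong₂ _,_ (≟-sound p₁) (≟-sound p₂))
... | inj₂ p = let p₁ , p₂ = ∧-true p in inj₂ (cong₂ _,_ (≟-sound p₁) (≟-sound p₂))

isPolygon? : (Fin n → Fin v × Fin v) → Polygon n v → Bool
isPolygon? ends (polygon vs es) =
  injective? (lookup vs) ∧ injective? (lookup es) ∧
  allFin (λ i → joins? ends (lookup es i) (lookup vs i) (lookup vs (next i)))

isPolygon?-sound : (ends : Fin n → Fin v × Fin v) (p : Polygon n v) → isPolygon? ends p ≡ true →
                   HasCycleIn ends (polygonEdges p)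
isPolygon?-sound ends (polygon {k} vs es) valid
  with ∧-true valid
... | vs-inj , rest with ∧-true rest
... | es-inj , joins =
  k , lookup vs , lookup es , injective?-sound _ vs-inj , injective?-sound _ es-inj ,
  edgeSet-∋ (lookup es) ,
  λ i → joins?-sound ends (allFin-sound (λ i → joins? ends (lookup es i) (lookup vs i) (lookup vs (next i))) joins i)

module _ (ends : Fin n → Fin v × Fin v) (cycle? : Sub n → Bool) where

  circuitsCovered? : Vec (Polygon n v) m → Bool
  circuitsCovered? ps = allSub λ Z →
    not (cycle? Z) ∨ not (anyFin Z) ∨ anyFin (λ i → isPolygon? ends (lookup ps i) ∧ polygonEdges (lookup ps i) ⊆? Z)

  cyclesCovered? : Bool
  cyclesCovered? = allSub λ Z → not (isCycle? (incidence ends) Z) ∨ cycle? Z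

  acyclic⇔cycleMatroid : Extensionalᵇ cycle? → (ps : Vec (Polygon n v) m) →
                         circuitsCovered? ps ≡ true → cyclesCovered? ≡ true →
                         ∀ X → Acyclic (λ Z → cycle? Z ≡ true) X ⇔ Indep (cycleMatroid ends) X
  acyclic⇔cycleMatroid ext ps circuits cycles X = mk⇔ forward backward
    where
    forward : Acyclic (λ Z → cycle? Z ≡ true) X → ¬ HasCycleIn ends X
    forward acyclic (k , vs , es , _ , es-inj , inX , joins)
      with ∨-true (allSub-sound _ cycles-ext cycles (edgeSet es))
      where
      cycles-ext : Extensionalᵇ (λ Z → not (isCycle? (incidence ends) Z) ∨ cycle? Z)
      cycles-ext Y≗Z = cong₂ (λ c d → not c ∨ d) (isCycle?-cong (incidence ends) Y≗Z) (ext Y≗Z)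
    ... | inj₁ notCycle =
      true≢false (isCycle?-complete (incidence ends) (cycleEdges-isCycle ends es-inj joins)) (not-true notCycle)
    ... | inj₂ cycle = true≢false (edgeSet-∋ es zero) (acyclic (edgeSet es) (edgeSet-⊆ es inX) cycle (es zero))
    backward : ¬ HasCycleIn ends X → Acyclic (λ Z → cycle? Z ≡ true) X
    backward acyclic Z Z⊆X cycZ with allSub-sound _ circuits-ext circuits Z
      where
      circuits-ext : Extensionalᵇ (λ Z → not (cycle? Z) ∨ not (anyFin Z) ∨
                       anyFin (λ i → isPolygon? ends (lookup ps i) ∧ polygonEdges (lookup ps i) ⊆? Z))
      circuits-ext Y≗Z = cong₂ (λ c r → not c ∨ r) (ext Y≗Z) (cong₂ (λ e r → not e ∨ r) (anyFin-cong Y≗Z)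
        (anyFin-cong (λ i → cong (isPolygon? ends (lookup ps i) ∧_) (⊆?-cong (λ _ → refl) Y≗Z))))
    ... | covered rewrite cycZ with ∨-true covered
    ... | inj₁ empty = anyFin-false Z (not-true empty)
    ... | inj₂ found with anyFin-sound (λ i → isPolygon? ends (lookup ps i) ∧ polygonEdges (lookup ps i) ⊆? Z) found
    ... | i , found-i with ∧-true found-i
    ... | valid , edges⊆Z = ⊥-elim (acyclic (HasCycleIn-mono ends (λ e p → Z⊆X e (⊆?-sound {W = polygonEdges (lookup ps i)} edges⊆Z e p))
                                                 (isPolygon?-sound ends (lookup ps i) valid)))

-- The cycle space of F₇*

-- C₄, C₅ and C₆ are the fundamental circuits of 4, 5 and 6 with respect to the basis B₀ of F₇*,
-- so span* Z is the cycle of F₇* that agrees with Z outside B₀, and the cycles of F₇* are the fixed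
-- points of span*.
B₀ C₄ C₅ C₆ : Sub 7
B₀ = fromList (# 0 ∷ # 1 ∷ # 2 ∷ # 3 ∷ [])
C₄ = fromList (# 1 ∷ # 2 ∷ # 3 ∷ # 4 ∷ [])
C₅ = fromList (# 0 ∷ # 2 ∷ # 3 ∷ # 5 ∷ [])
C₆ = fromList (# 0 ∷ # 1 ∷ # 3 ∷ # 6 ∷ [])

span* : Sub 7 → Sub 7
span* Z = Z (# 4) · C₄ ⊕ Z (# 5) · C₅ ⊕ Z (# 6) · C₆

span*-agrees : ∀ Z → span* Z (# 4) ≡ Z (# 4) × span* Z (# 5) ≡ Z (# 5) × span* Z (# 6) ≡ Z (# 6)
span*-agrees Z with Z (# 4) | Z (# 5) | Z (# 6)
... | false | false | false = refl , refl , refl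
... | false | false | true  = refl , refl , refl
... | false | true  | false = refl , refl , refl
... | false | true  | true  = refl , refl , refl
... | true  | false | false = refl , refl , refl
... | true  | false | true  = refl , refl , refl
... | true  | true  | false = refl , refl , refl
... | true  | true  | true  = refl , refl , refl

span*-determined : ∀ Y Z → Y (# 4) ≡ Z (# 4) → Y (# 5) ≡ Z (# 5) → Y (# 6) ≡ Z (# 6) →
                   span* Y ≗ span* Z
span*-determined Y Z e₄ e₅ e₆ i rewrite e₄ | e₅ | e₆ = refl

span*-cong : ∀ {Y Z} → Y ≗ Z → span* Y ≗ span* Z
span*-cong {Y} {Z} Y≗Z = span*-determined Y Z (Y≗Z (# 4)) (Y≗Z (# 5)) (Y≗Z (# 6))

span*-idempotent : ∀ Z → span* (span* Z) ≗ span* Z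
span*-idempotent Z = let e₄ , e₅ , e₆ = span*-agrees Z in span*-determined (span* Z) Z e₄ e₅ e₆

span*-⊕ : ∀ Y Z → span* (Y ⊕ Z) ≗ span* Y ⊕ span* Z
span*-⊕ Y Z i = begin
  ((Y (# 4) xor Z (# 4)) ∧ C₄ i) xor ((Y (# 5) xor Z (# 5)) ∧ C₅ i) xor ((Y (# 6) xor Z (# 6)) ∧ C₆ i)
    ≡⟨ cong₂ _xor_ (∧-distribʳ-xor (C₄ i) (Y (# 4)) (Z (# 4)))
                   (cong₂ _xor_ (∧-distribʳ-xor (C₅ i) (Y (# 5)) (Z (# 5)))
                                (∧-distribʳ-xor (C₆ i) (Y (# 6)) (Z (# 6)))) ⟩
  (y₄ xor z₄) xor (y₅ xor z₅) xor (y₆ xor z₆)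
    ≡⟨ cong ((y₄ xor z₄) xor_) (interchange y₅ z₅ y₆ z₆) ⟩
  (y₄ xor z₄) xor (y₅ xor y₆) xor (z₅ xor z₆)
    ≡⟨ interchange y₄ z₄ (y₅ xor y₆) (z₅ xor z₆) ⟩
  (y₄ xor y₅ xor y₆) xor (z₄ xor z₅ xor z₆) ∎
  where
  y₄ y₅ y₆ z₄ z₅ z₆ : Bool
  y₄ = Y (# 4) ∧ C₄ i
  y₅ = Y (# 5) ∧ C₅ i
  y₆ = Y (# 6) ∧ C₆ i
  z₄ = Z (# 4) ∧ C₄ i
  z₅ = Z (# 5) ∧ C₅ i
  z₆ = Z (# 6) ∧ C₆ i

C₄-circuit : IsCircuit F₇* C₄
C₄-circuit = isDualCircuit?-sound fanoMatrix C₄ refl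

C₅-circuit : IsCircuit F₇* C₅
C₅-circuit = isDualCircuit?-sound fanoMatrix C₅ refl

C₆-circuit : IsCircuit F₇* C₆
C₆-circuit = isDualCircuit?-sound fanoMatrix C₆ refl

B₀-indep : Indep F₇* B₀
B₀-indep = dualIndep?-sound fanoMatrix B₀ refl

residual⊆B₀ : ∀ Z → Z ⊕ span* Z ⊆ B₀
residual⊆B₀ Z = ⊆?-sound {W = Z ⊕ span* Z} {B₀} (allSub-sound (λ Z → Z ⊕ span* Z ⊆? B₀) ext refl Z)
  where
  ext : Extensionalᵇ (λ Z → Z ⊕ span* Z ⊆? B₀)
  ext Y≗Z = ⊆?-cong {X = B₀} (λ i → cong₂ _xor_ (Y≗Z i) (span*-cong Y≗Z i)) (λ _ → refl)

F₇-ext : Extensional (Indep F₇)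
F₇-ext X≗Y = Acyclic-mono (≗-⊆ (λ i → sym (X≗Y i)) ⊆-refl)

F₇*-ext : Extensional (Indep F₇*)
F₇*-ext X≗Y (B , basis , avoids) = B , basis , λ i Yi → avoids i (trans (X≗Y i) Yi)

F₇-∅ : Indep F₇ ∅
F₇-∅ = colIndep?-sound fanoMatrix ∅ refl

F₇*-∅ : Indep F₇* ∅
F₇*-∅ = dualIndep?-sound fanoMatrix ∅ refl

F₇*-cycle? : Sub 7 → Bool
F₇*-cycle? Z = allFin (λ i → not (Z i xor span* Z i))

F₇*-cycle?-sound : ∀ Z → F₇*-cycle? Z ≡ true → Z ≗ span* Z
F₇*-cycle?-sound Z cyc i = xor≡false⇒≡ (not-true (allFin-sound (λ i → not (Z i xor span* Z i)) cyc i))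

F₇*-cycle?-complete : ∀ Z → Z ≗ span* Z → F₇*-cycle? Z ≡ true
F₇*-cycle?-complete Z Z≗ =
  allFin-complete _ (λ i → subst (λ b → not (Z i xor b) ≡ true) (Z≗ i) (cong not (xor-same (Z i))))

F₇*-cycle?-cong : Extensionalᵇ F₇*-cycle?
F₇*-cycle?-cong Y≗Z =
  allFin-cong (λ i → cong₂ (λ y s → not (y xor s)) (Y≗Z i) (span*-cong Y≗Z i))

F₇*-cycle?-⊕ : ∀ Y Z → F₇*-cycle? Y ≡ true → F₇*-cycle? Z ≡ true → F₇*-cycle? (Y ⊕ Z) ≡ true
F₇*-cycle?-⊕ Y Z cycY cycZ = F₇*-cycle?-complete (Y ⊕ Z) λ i →
  trans (cong₂ _xor_ (F₇*-cycle?-sound Y cycY i) (F₇*-cycle?-sound Z cycZ i)) (sym (span*-⊕ Y Z i))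

F₇*-cycle?-span* : ∀ Z → F₇*-cycle? (span* Z) ≡ true
F₇*-cycle?-span* Z = F₇*-cycle?-complete (span* Z) (λ i → sym (span*-idempotent Z i))

-- Elementary quotients of F₇*

-- When N ∖ a is F₇* and y ∪ {a} is a cycle of N, the cycles of N / a are the sets Z such that Z
-- or Z ⊕ y is a cycle of F₇*.
quotientCycle? : Sub 7 → Sub 7 → Bool
quotientCycle? y Z = F₇*-cycle? Z ∨ F₇*-cycle? (Z ⊕ y)

QuotientCycle : Sub 7 → Sub 7 → Set
QuotientCycle y Z = quotientCycle? y Z ≡ true

quotientCycle?-cong : ∀ y → Extensionalᵇ (quotientCycle? y)
quotientCycle?-cong y Y≗Z =
  cong₂ _∨_ (F₇*-cycle?-cong Y≗Z) (F₇*-cycle?-cong (λ i → cong (_xor y i) (Y≗Z i)))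

quotientCycle?-coset : ∀ y l → F₇*-cycle? (y ⊕ l) ≡ true →
                       ∀ Z → quotientCycle? y Z ≡ quotientCycle? l Z
quotientCycle?-coset y l y~l Z = cong (F₇*-cycle? Z ∨_) (bool-ext
  (λ cyc → trans (F₇*-cycle?-cong (λ i → sym (xor-telescope (Z i) (y i) (l i))))
                 (F₇*-cycle?-⊕ (Z ⊕ y) (y ⊕ l) cyc y~l))
  (λ cyc → trans (F₇*-cycle?-cong (λ i → sym (trans (cong ((Z i xor l i) xor_) (xor-comm (y i) (l i)))
                                                      (xor-telescope (Z i) (l i) (y i)))))
                 (F₇*-cycle?-⊕ (Z ⊕ l) (y ⊕ l) cyc y~l)))

data QuotientType (y : Sub 7) : Set where
  trivial : F₇*-cycle? y ≡ true → QuotientType y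
  fano    : (∀ Z → quotientCycle? y Z ≡ isCycle? fanoMatrix Z) → QuotientType y
  graphic : (ends : Fin 7 → Fin 4 × Fin 4) →
            (∀ X → Acyclic (QuotientCycle y) X ⇔ Indep (cycleMatroid ends) X) → QuotientType y

QuotientType-coset : ∀ {y l} → F₇*-cycle? (y ⊕ l) ≡ true → QuotientType l → QuotientType y
QuotientType-coset {y} {l} y~l (trivial cycl) =
  trivial (trans (F₇*-cycle?-cong (λ i → sym (⊕-cancelʳ y l i))) (F₇*-cycle?-⊕ (y ⊕ l) l y~l cycl))
QuotientType-coset {y} {l} y~l (fano l≡F₇) = fano (λ Z → trans (quotientCycle?-coset y l y~l Z) (l≡F₇ Z))
QuotientType-coset {y} {l} y~l (graphic ends l≅G) = graphic ends λ X → ⇔-trans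
  (mk⇔ (Acyclic-antitone (λ Z → trans (quotientCycle?-coset y l y~l Z)))
       (Acyclic-antitone (λ Z → trans (sym (quotientCycle?-coset y l y~l Z)))))
  (l≅G X)

onB₀ : Bool → Bool → Bool → Bool → Sub 7
onB₀ b₀ b₁ b₂ b₃ = lookup (b₀ ∷ b₁ ∷ b₂ ∷ b₃ ∷ false ∷ false ∷ false ∷ [])

graphic-by : ∀ {y m} (edges : Vec (Fin 4 × Fin 4) 7) (ps : Vec (Polygon 7 4) m) →
             circuitsCovered? (lookup edges) (quotientCycle? y) ps ≡ true →
             cyclesCovered? (lookup edges) (quotientCycle? y) ≡ true → QuotientType y
graphic-by {y} edges ps circuits cycles = graphic (lookup edges)
  (acyclic⇔cycleMatroid (lookup edges) (quotientCycle? y) (quotientCycle?-cong y) ps circuits cycles)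

-- The graphs and their circuits were found by a computer search; refl checks that each graph has
-- the cycles of the corresponding quotient.
classify-B₀ : ∀ b₀ b₁ b₂ b₃ → QuotientType (onB₀ b₀ b₁ b₂ b₃)
classify-B₀ false false false false = trivial refl
classify-B₀ true  true  true  false =
  fano (allSub-≡ _ _ (quotientCycle?-cong (onB₀ true true true false)) (isCycle?-cong fanoMatrix) refl)
classify-B₀ false false false true = graphic-by
  ((# 0 , # 3) ∷ (# 0 , # 2) ∷ (# 0 , # 1) ∷ (# 3 , # 3) ∷ (# 1 , # 2) ∷ (# 1 , # 3) ∷ (# 2 , # 3) ∷ [])
  ( polygon (# 3 ∷ # 0 ∷ # 2 ∷ []) (# 0 ∷ # 1 ∷ # 6 ∷ [])
  ∷ polygon (# 3 ∷ # 0 ∷ # 1 ∷ []) (# 0 ∷ # 2 ∷ # 5 ∷ [])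
  ∷ polygon (# 2 ∷ # 0 ∷ # 1 ∷ # 3 ∷ []) (# 1 ∷ # 2 ∷ # 5 ∷ # 6 ∷ [])
  ∷ polygon (# 3 ∷ []) (# 3 ∷ [])
  ∷ polygon (# 2 ∷ # 1 ∷ # 3 ∷ []) (# 4 ∷ # 5 ∷ # 6 ∷ [])
  ∷ polygon (# 3 ∷ # 0 ∷ # 2 ∷ # 1 ∷ []) (# 0 ∷ # 1 ∷ # 4 ∷ # 5 ∷ [])
  ∷ polygon (# 3 ∷ # 0 ∷ # 1 ∷ # 2 ∷ []) (# 0 ∷ # 2 ∷ # 4 ∷ # 6 ∷ [])
  ∷ polygon (# 2 ∷ # 0 ∷ # 1 ∷ []) (# 1 ∷ # 2 ∷ # 4 ∷ [])
  ∷ [])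
  refl refl
classify-B₀ false false true false = graphic-by
  ((# 0 , # 3) ∷ (# 1 , # 2) ∷ (# 3 , # 3) ∷ (# 0 , # 1) ∷ (# 0 , # 2) ∷ (# 1 , # 3) ∷ (# 2 , # 3) ∷ [])
  ( polygon (# 2 ∷ # 1 ∷ # 3 ∷ []) (# 1 ∷ # 5 ∷ # 6 ∷ [])
  ∷ polygon (# 3 ∷ []) (# 2 ∷ [])
  ∷ polygon (# 3 ∷ # 0 ∷ # 1 ∷ []) (# 0 ∷ # 3 ∷ # 5 ∷ [])
  ∷ polygon (# 3 ∷ # 0 ∷ # 1 ∷ # 2 ∷ []) (# 0 ∷ # 3 ∷ # 1 ∷ # 6 ∷ [])
  ∷ polygon (# 3 ∷ # 0 ∷ # 2 ∷ []) (# 0 ∷ # 4 ∷ # 6 ∷ [])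
  ∷ polygon (# 3 ∷ # 0 ∷ # 2 ∷ # 1 ∷ []) (# 0 ∷ # 4 ∷ # 1 ∷ # 5 ∷ [])
  ∷ polygon (# 1 ∷ # 0 ∷ # 2 ∷ # 3 ∷ []) (# 3 ∷ # 4 ∷ # 6 ∷ # 5 ∷ [])
  ∷ polygon (# 2 ∷ # 1 ∷ # 0 ∷ []) (# 1 ∷ # 3 ∷ # 4 ∷ [])
  ∷ [])
  refl refl
classify-B₀ false false true true = graphic-by
  ((# 1 , # 3) ∷ (# 0 , # 2) ∷ (# 0 , # 1) ∷ (# 0 , # 1) ∷ (# 0 , # 2) ∷ (# 1 , # 3) ∷ (# 2 , # 3) ∷ [])
  ( polygon (# 1 ∷ # 3 ∷ []) (# 0 ∷ # 5 ∷ [])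
  ∷ polygon (# 2 ∷ # 0 ∷ # 1 ∷ # 3 ∷ []) (# 1 ∷ # 2 ∷ # 5 ∷ # 6 ∷ [])
  ∷ polygon (# 3 ∷ # 1 ∷ # 0 ∷ # 2 ∷ []) (# 0 ∷ # 2 ∷ # 1 ∷ # 6 ∷ [])
  ∷ polygon (# 2 ∷ # 0 ∷ # 1 ∷ # 3 ∷ []) (# 1 ∷ # 3 ∷ # 5 ∷ # 6 ∷ [])
  ∷ polygon (# 3 ∷ # 1 ∷ # 0 ∷ # 2 ∷ []) (# 0 ∷ # 3 ∷ # 1 ∷ # 6 ∷ [])
  ∷ polygon (# 0 ∷ # 1 ∷ []) (# 2 ∷ # 3 ∷ [])
  ∷ polygon (# 0 ∷ # 2 ∷ []) (# 1 ∷ # 4 ∷ [])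
  ∷ polygon (# 1 ∷ # 0 ∷ # 2 ∷ # 3 ∷ []) (# 2 ∷ # 4 ∷ # 6 ∷ # 5 ∷ [])
  ∷ polygon (# 3 ∷ # 1 ∷ # 0 ∷ # 2 ∷ []) (# 0 ∷ # 2 ∷ # 4 ∷ # 6 ∷ [])
  ∷ polygon (# 1 ∷ # 0 ∷ # 2 ∷ # 3 ∷ []) (# 3 ∷ # 4 ∷ # 6 ∷ # 5 ∷ [])
  ∷ polygon (# 3 ∷ # 1 ∷ # 0 ∷ # 2 ∷ []) (# 0 ∷ # 3 ∷ # 4 ∷ # 6 ∷ [])
  ∷ [])
  refl refl
classify-B₀ false true false false = graphic-by
  ((# 0 , # 3) ∷ (# 3 , # 3) ∷ (# 1 , # 2) ∷ (# 0 , # 2) ∷ (# 0 , # 1) ∷ (# 1 , # 3) ∷ (# 2 , # 3) ∷ [])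
  ( polygon (# 3 ∷ []) (# 1 ∷ [])
  ∷ polygon (# 2 ∷ # 1 ∷ # 3 ∷ []) (# 2 ∷ # 5 ∷ # 6 ∷ [])
  ∷ polygon (# 3 ∷ # 0 ∷ # 2 ∷ []) (# 0 ∷ # 3 ∷ # 6 ∷ [])
  ∷ polygon (# 3 ∷ # 0 ∷ # 2 ∷ # 1 ∷ []) (# 0 ∷ # 3 ∷ # 2 ∷ # 5 ∷ [])
  ∷ polygon (# 3 ∷ # 0 ∷ # 1 ∷ []) (# 0 ∷ # 4 ∷ # 5 ∷ [])
  ∷ polygon (# 3 ∷ # 0 ∷ # 1 ∷ # 2 ∷ []) (# 0 ∷ # 4 ∷ # 2 ∷ # 6 ∷ [])
  ∷ polygon (# 2 ∷ # 0 ∷ # 1 ∷ # 3 ∷ []) (# 3 ∷ # 4 ∷ # 5 ∷ # 6 ∷ [])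
  ∷ polygon (# 1 ∷ # 2 ∷ # 0 ∷ []) (# 2 ∷ # 3 ∷ # 4 ∷ [])
  ∷ [])
  refl refl
classify-B₀ false true false true = graphic-by
  ((# 2 , # 3) ∷ (# 0 , # 1) ∷ (# 0 , # 2) ∷ (# 0 , # 1) ∷ (# 0 , # 2) ∷ (# 1 , # 3) ∷ (# 2 , # 3) ∷ [])
  ( polygon (# 2 ∷ # 3 ∷ []) (# 0 ∷ # 6 ∷ [])
  ∷ polygon (# 1 ∷ # 0 ∷ # 2 ∷ # 3 ∷ []) (# 1 ∷ # 2 ∷ # 6 ∷ # 5 ∷ [])
  ∷ polygon (# 3 ∷ # 2 ∷ # 0 ∷ # 1 ∷ []) (# 0 ∷ # 2 ∷ # 1 ∷ # 5 ∷ [])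
  ∷ polygon (# 0 ∷ # 1 ∷ []) (# 1 ∷ # 3 ∷ [])
  ∷ polygon (# 2 ∷ # 0 ∷ # 1 ∷ # 3 ∷ []) (# 2 ∷ # 3 ∷ # 5 ∷ # 6 ∷ [])
  ∷ polygon (# 3 ∷ # 2 ∷ # 0 ∷ # 1 ∷ []) (# 0 ∷ # 2 ∷ # 3 ∷ # 5 ∷ [])
  ∷ polygon (# 1 ∷ # 0 ∷ # 2 ∷ # 3 ∷ []) (# 1 ∷ # 4 ∷ # 6 ∷ # 5 ∷ [])
  ∷ polygon (# 3 ∷ # 2 ∷ # 0 ∷ # 1 ∷ []) (# 0 ∷ # 4 ∷ # 1 ∷ # 5 ∷ [])
  ∷ polygon (# 0 ∷ # 2 ∷ []) (# 2 ∷ # 4 ∷ [])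
  ∷ polygon (# 1 ∷ # 0 ∷ # 2 ∷ # 3 ∷ []) (# 3 ∷ # 4 ∷ # 6 ∷ # 5 ∷ [])
  ∷ polygon (# 3 ∷ # 2 ∷ # 0 ∷ # 1 ∷ []) (# 0 ∷ # 4 ∷ # 3 ∷ # 5 ∷ [])
  ∷ [])
  refl refl
classify-B₀ false true true false = graphic-by
  ((# 0 , # 1) ∷ (# 0 , # 2) ∷ (# 0 , # 2) ∷ (# 1 , # 3) ∷ (# 1 , # 3) ∷ (# 2 , # 3) ∷ (# 2 , # 3) ∷ [])
  ( polygon (# 2 ∷ # 3 ∷ []) (# 5 ∷ # 6 ∷ [])
  ∷ polygon (# 0 ∷ # 2 ∷ []) (# 1 ∷ # 2 ∷ [])
  ∷ polygon (# 1 ∷ # 0 ∷ # 2 ∷ # 3 ∷ []) (# 0 ∷ # 1 ∷ # 6 ∷ # 3 ∷ [])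
  ∷ polygon (# 1 ∷ # 0 ∷ # 2 ∷ # 3 ∷ []) (# 0 ∷ # 1 ∷ # 5 ∷ # 3 ∷ [])
  ∷ polygon (# 1 ∷ # 0 ∷ # 2 ∷ # 3 ∷ []) (# 0 ∷ # 2 ∷ # 6 ∷ # 3 ∷ [])
  ∷ polygon (# 1 ∷ # 0 ∷ # 2 ∷ # 3 ∷ []) (# 0 ∷ # 2 ∷ # 5 ∷ # 3 ∷ [])
  ∷ polygon (# 1 ∷ # 0 ∷ # 2 ∷ # 3 ∷ []) (# 0 ∷ # 1 ∷ # 5 ∷ # 4 ∷ [])
  ∷ polygon (# 1 ∷ # 0 ∷ # 2 ∷ # 3 ∷ []) (# 0 ∷ # 1 ∷ # 6 ∷ # 4 ∷ [])
  ∷ polygon (# 1 ∷ # 0 ∷ # 2 ∷ # 3 ∷ []) (# 0 ∷ # 2 ∷ # 5 ∷ # 4 ∷ [])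
  ∷ polygon (# 1 ∷ # 0 ∷ # 2 ∷ # 3 ∷ []) (# 0 ∷ # 2 ∷ # 6 ∷ # 4 ∷ [])
  ∷ polygon (# 1 ∷ # 3 ∷ []) (# 3 ∷ # 4 ∷ [])
  ∷ [])
  refl refl
classify-B₀ false true true true = graphic-by
  ((# 0 , # 3) ∷ (# 0 , # 1) ∷ (# 0 , # 2) ∷ (# 1 , # 2) ∷ (# 3 , # 3) ∷ (# 1 , # 3) ∷ (# 2 , # 3) ∷ [])
  ( polygon (# 3 ∷ # 0 ∷ # 1 ∷ []) (# 0 ∷ # 1 ∷ # 5 ∷ [])
  ∷ polygon (# 3 ∷ # 0 ∷ # 2 ∷ []) (# 0 ∷ # 2 ∷ # 6 ∷ [])
  ∷ polygon (# 1 ∷ # 0 ∷ # 2 ∷ # 3 ∷ []) (# 1 ∷ # 2 ∷ # 6 ∷ # 5 ∷ [])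
  ∷ polygon (# 2 ∷ # 1 ∷ # 3 ∷ []) (# 3 ∷ # 5 ∷ # 6 ∷ [])
  ∷ polygon (# 3 ∷ # 0 ∷ # 1 ∷ # 2 ∷ []) (# 0 ∷ # 1 ∷ # 3 ∷ # 6 ∷ [])
  ∷ polygon (# 3 ∷ # 0 ∷ # 2 ∷ # 1 ∷ []) (# 0 ∷ # 2 ∷ # 3 ∷ # 5 ∷ [])
  ∷ polygon (# 1 ∷ # 0 ∷ # 2 ∷ []) (# 1 ∷ # 2 ∷ # 3 ∷ [])
  ∷ polygon (# 3 ∷ []) (# 4 ∷ [])
  ∷ [])
  refl refl
classify-B₀ true false false false = graphic-by
  ((# 3 , # 3) ∷ (# 0 , # 3) ∷ (# 1 , # 2) ∷ (# 0 , # 2) ∷ (# 1 , # 3) ∷ (# 0 , # 1) ∷ (# 2 , # 3) ∷ [])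
  ( polygon (# 3 ∷ []) (# 0 ∷ [])
  ∷ polygon (# 3 ∷ # 0 ∷ # 1 ∷ # 2 ∷ []) (# 1 ∷ # 5 ∷ # 2 ∷ # 6 ∷ [])
  ∷ polygon (# 3 ∷ # 0 ∷ # 2 ∷ []) (# 1 ∷ # 3 ∷ # 6 ∷ [])
  ∷ polygon (# 1 ∷ # 2 ∷ # 0 ∷ []) (# 2 ∷ # 3 ∷ # 5 ∷ [])
  ∷ polygon (# 0 ∷ # 3 ∷ # 1 ∷ []) (# 1 ∷ # 4 ∷ # 5 ∷ [])
  ∷ polygon (# 2 ∷ # 1 ∷ # 3 ∷ []) (# 2 ∷ # 4 ∷ # 6 ∷ [])
  ∷ polygon (# 2 ∷ # 0 ∷ # 1 ∷ # 3 ∷ []) (# 3 ∷ # 5 ∷ # 4 ∷ # 6 ∷ [])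
  ∷ polygon (# 3 ∷ # 0 ∷ # 2 ∷ # 1 ∷ []) (# 1 ∷ # 3 ∷ # 2 ∷ # 4 ∷ [])
  ∷ [])
  refl refl
classify-B₀ true false false true = graphic-by
  ((# 0 , # 1) ∷ (# 2 , # 3) ∷ (# 1 , # 3) ∷ (# 0 , # 1) ∷ (# 0 , # 2) ∷ (# 1 , # 3) ∷ (# 2 , # 3) ∷ [])
  ( polygon (# 2 ∷ # 3 ∷ []) (# 1 ∷ # 6 ∷ [])
  ∷ polygon (# 1 ∷ # 3 ∷ []) (# 2 ∷ # 5 ∷ [])
  ∷ polygon (# 0 ∷ # 1 ∷ []) (# 0 ∷ # 3 ∷ [])
  ∷ polygon (# 1 ∷ # 0 ∷ # 2 ∷ # 3 ∷ []) (# 0 ∷ # 4 ∷ # 6 ∷ # 5 ∷ [])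
  ∷ polygon (# 1 ∷ # 0 ∷ # 2 ∷ # 3 ∷ []) (# 0 ∷ # 4 ∷ # 1 ∷ # 5 ∷ [])
  ∷ polygon (# 0 ∷ # 1 ∷ # 3 ∷ # 2 ∷ []) (# 0 ∷ # 2 ∷ # 6 ∷ # 4 ∷ [])
  ∷ polygon (# 0 ∷ # 1 ∷ # 3 ∷ # 2 ∷ []) (# 0 ∷ # 2 ∷ # 1 ∷ # 4 ∷ [])
  ∷ polygon (# 1 ∷ # 0 ∷ # 2 ∷ # 3 ∷ []) (# 3 ∷ # 4 ∷ # 6 ∷ # 5 ∷ [])
  ∷ polygon (# 3 ∷ # 2 ∷ # 0 ∷ # 1 ∷ []) (# 1 ∷ # 4 ∷ # 3 ∷ # 5 ∷ [])
  ∷ polygon (# 3 ∷ # 1 ∷ # 0 ∷ # 2 ∷ []) (# 2 ∷ # 3 ∷ # 4 ∷ # 6 ∷ [])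
  ∷ polygon (# 2 ∷ # 3 ∷ # 1 ∷ # 0 ∷ []) (# 1 ∷ # 2 ∷ # 3 ∷ # 4 ∷ [])
  ∷ [])
  refl refl
classify-B₀ true false true false = graphic-by
  ((# 0 , # 2) ∷ (# 0 , # 1) ∷ (# 0 , # 2) ∷ (# 1 , # 3) ∷ (# 2 , # 3) ∷ (# 1 , # 3) ∷ (# 2 , # 3) ∷ [])
  ( polygon (# 2 ∷ # 0 ∷ # 1 ∷ # 3 ∷ []) (# 0 ∷ # 1 ∷ # 5 ∷ # 6 ∷ [])
  ∷ polygon (# 0 ∷ # 2 ∷ []) (# 0 ∷ # 2 ∷ [])
  ∷ polygon (# 1 ∷ # 0 ∷ # 2 ∷ # 3 ∷ []) (# 1 ∷ # 2 ∷ # 6 ∷ # 5 ∷ [])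
  ∷ polygon (# 1 ∷ # 3 ∷ []) (# 3 ∷ # 5 ∷ [])
  ∷ polygon (# 2 ∷ # 0 ∷ # 1 ∷ # 3 ∷ []) (# 0 ∷ # 1 ∷ # 3 ∷ # 6 ∷ [])
  ∷ polygon (# 1 ∷ # 0 ∷ # 2 ∷ # 3 ∷ []) (# 1 ∷ # 2 ∷ # 6 ∷ # 3 ∷ [])
  ∷ polygon (# 2 ∷ # 3 ∷ []) (# 4 ∷ # 6 ∷ [])
  ∷ polygon (# 2 ∷ # 0 ∷ # 1 ∷ # 3 ∷ []) (# 0 ∷ # 1 ∷ # 5 ∷ # 4 ∷ [])
  ∷ polygon (# 1 ∷ # 0 ∷ # 2 ∷ # 3 ∷ []) (# 1 ∷ # 2 ∷ # 4 ∷ # 5 ∷ [])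
  ∷ polygon (# 2 ∷ # 0 ∷ # 1 ∷ # 3 ∷ []) (# 0 ∷ # 1 ∷ # 3 ∷ # 4 ∷ [])
  ∷ polygon (# 1 ∷ # 0 ∷ # 2 ∷ # 3 ∷ []) (# 1 ∷ # 2 ∷ # 4 ∷ # 3 ∷ [])
  ∷ [])
  refl refl
classify-B₀ true false true true = graphic-by
  ((# 0 , # 1) ∷ (# 0 , # 3) ∷ (# 0 , # 2) ∷ (# 1 , # 2) ∷ (# 1 , # 3) ∷ (# 3 , # 3) ∷ (# 2 , # 3) ∷ [])
  ( polygon (# 3 ∷ []) (# 5 ∷ [])
  ∷ polygon (# 3 ∷ # 0 ∷ # 2 ∷ []) (# 1 ∷ # 2 ∷ # 6 ∷ [])
  ∷ polygon (# 1 ∷ # 0 ∷ # 3 ∷ # 2 ∷ []) (# 0 ∷ # 1 ∷ # 6 ∷ # 3 ∷ [])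
  ∷ polygon (# 1 ∷ # 0 ∷ # 2 ∷ []) (# 0 ∷ # 2 ∷ # 3 ∷ [])
  ∷ polygon (# 1 ∷ # 0 ∷ # 3 ∷ []) (# 0 ∷ # 1 ∷ # 4 ∷ [])
  ∷ polygon (# 1 ∷ # 0 ∷ # 2 ∷ # 3 ∷ []) (# 0 ∷ # 2 ∷ # 6 ∷ # 4 ∷ [])
  ∷ polygon (# 2 ∷ # 1 ∷ # 3 ∷ []) (# 3 ∷ # 4 ∷ # 6 ∷ [])
  ∷ polygon (# 3 ∷ # 0 ∷ # 2 ∷ # 1 ∷ []) (# 1 ∷ # 2 ∷ # 3 ∷ # 4 ∷ [])
  ∷ [])
  refl refl
classify-B₀ true true false false = graphic-by
  ((# 0 , # 1) ∷ (# 0 , # 1) ∷ (# 0 , # 2) ∷ (# 2 , # 3) ∷ (# 1 , # 3) ∷ (# 1 , # 3) ∷ (# 2 , # 3) ∷ [])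
  ( polygon (# 0 ∷ # 1 ∷ []) (# 0 ∷ # 1 ∷ [])
  ∷ polygon (# 1 ∷ # 0 ∷ # 2 ∷ # 3 ∷ []) (# 0 ∷ # 2 ∷ # 6 ∷ # 5 ∷ [])
  ∷ polygon (# 1 ∷ # 0 ∷ # 2 ∷ # 3 ∷ []) (# 1 ∷ # 2 ∷ # 6 ∷ # 5 ∷ [])
  ∷ polygon (# 2 ∷ # 3 ∷ []) (# 3 ∷ # 6 ∷ [])
  ∷ polygon (# 1 ∷ # 0 ∷ # 2 ∷ # 3 ∷ []) (# 0 ∷ # 2 ∷ # 3 ∷ # 5 ∷ [])
  ∷ polygon (# 1 ∷ # 0 ∷ # 2 ∷ # 3 ∷ []) (# 1 ∷ # 2 ∷ # 3 ∷ # 5 ∷ [])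
  ∷ polygon (# 1 ∷ # 3 ∷ []) (# 4 ∷ # 5 ∷ [])
  ∷ polygon (# 1 ∷ # 0 ∷ # 2 ∷ # 3 ∷ []) (# 0 ∷ # 2 ∷ # 6 ∷ # 4 ∷ [])
  ∷ polygon (# 1 ∷ # 0 ∷ # 2 ∷ # 3 ∷ []) (# 1 ∷ # 2 ∷ # 6 ∷ # 4 ∷ [])
  ∷ polygon (# 1 ∷ # 0 ∷ # 2 ∷ # 3 ∷ []) (# 0 ∷ # 2 ∷ # 3 ∷ # 4 ∷ [])
  ∷ polygon (# 1 ∷ # 0 ∷ # 2 ∷ # 3 ∷ []) (# 1 ∷ # 2 ∷ # 3 ∷ # 4 ∷ [])
  ∷ [])
  refl refl
classify-B₀ true true false true = graphic-by
  ((# 0 , # 1) ∷ (# 0 , # 2) ∷ (# 0 , # 3) ∷ (# 1 , # 2) ∷ (# 1 , # 3) ∷ (# 2 , # 3) ∷ (# 3 , # 3) ∷ [])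
  ( polygon (# 3 ∷ []) (# 6 ∷ [])
  ∷ polygon (# 2 ∷ # 0 ∷ # 3 ∷ []) (# 1 ∷ # 2 ∷ # 5 ∷ [])
  ∷ polygon (# 1 ∷ # 0 ∷ # 2 ∷ []) (# 0 ∷ # 1 ∷ # 3 ∷ [])
  ∷ polygon (# 1 ∷ # 0 ∷ # 3 ∷ # 2 ∷ []) (# 0 ∷ # 2 ∷ # 5 ∷ # 3 ∷ [])
  ∷ polygon (# 1 ∷ # 0 ∷ # 2 ∷ # 3 ∷ []) (# 0 ∷ # 1 ∷ # 5 ∷ # 4 ∷ [])
  ∷ polygon (# 1 ∷ # 0 ∷ # 3 ∷ []) (# 0 ∷ # 2 ∷ # 4 ∷ [])
  ∷ polygon (# 2 ∷ # 1 ∷ # 3 ∷ []) (# 3 ∷ # 4 ∷ # 5 ∷ [])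
  ∷ polygon (# 2 ∷ # 0 ∷ # 3 ∷ # 1 ∷ []) (# 1 ∷ # 2 ∷ # 4 ∷ # 3 ∷ [])
  ∷ [])
  refl refl
classify-B₀ true true true true = graphic-by
  ((# 0 , # 2) ∷ (# 1 , # 3) ∷ (# 2 , # 3) ∷ (# 0 , # 1) ∷ (# 0 , # 2) ∷ (# 1 , # 3) ∷ (# 2 , # 3) ∷ [])
  ( polygon (# 1 ∷ # 3 ∷ []) (# 1 ∷ # 5 ∷ [])
  ∷ polygon (# 2 ∷ # 3 ∷ []) (# 2 ∷ # 6 ∷ [])
  ∷ polygon (# 2 ∷ # 0 ∷ # 1 ∷ # 3 ∷ []) (# 0 ∷ # 3 ∷ # 5 ∷ # 6 ∷ [])
  ∷ polygon (# 2 ∷ # 0 ∷ # 1 ∷ # 3 ∷ []) (# 0 ∷ # 3 ∷ # 1 ∷ # 6 ∷ [])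
  ∷ polygon (# 0 ∷ # 2 ∷ # 3 ∷ # 1 ∷ []) (# 0 ∷ # 2 ∷ # 5 ∷ # 3 ∷ [])
  ∷ polygon (# 0 ∷ # 2 ∷ # 3 ∷ # 1 ∷ []) (# 0 ∷ # 2 ∷ # 1 ∷ # 3 ∷ [])
  ∷ polygon (# 0 ∷ # 2 ∷ []) (# 0 ∷ # 4 ∷ [])
  ∷ polygon (# 1 ∷ # 0 ∷ # 2 ∷ # 3 ∷ []) (# 3 ∷ # 4 ∷ # 6 ∷ # 5 ∷ [])
  ∷ polygon (# 3 ∷ # 1 ∷ # 0 ∷ # 2 ∷ []) (# 1 ∷ # 3 ∷ # 4 ∷ # 6 ∷ [])
  ∷ polygon (# 3 ∷ # 2 ∷ # 0 ∷ # 1 ∷ []) (# 2 ∷ # 4 ∷ # 3 ∷ # 5 ∷ [])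
  ∷ polygon (# 1 ∷ # 3 ∷ # 2 ∷ # 0 ∷ []) (# 1 ∷ # 2 ∷ # 4 ∷ # 3 ∷ [])
  ∷ [])
  refl refl

classify : ∀ y → QuotientType y
classify y = QuotientType-coset y~l (classify-B₀ (ρ (# 0)) (ρ (# 1)) (ρ (# 2)) (ρ (# 3)))
  where
  ρ l : Sub 7
  ρ = y ⊕ span* y
  l = onB₀ (ρ (# 0)) (ρ (# 1)) (ρ (# 2)) (ρ (# 3))
  agrees₄ : span* y (# 4) ≡ y (# 4)
  agrees₄ = proj₁ (span*-agrees y)
  agrees₅ : span* y (# 5) ≡ y (# 5)
  agrees₅ = proj₁ (proj₂ (span*-agrees y))
  agrees₆ : span* y (# 6) ≡ y (# 6)
  agrees₆ = proj₂ (proj₂ (span*-agrees y))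
  y⊕l≗span* : y ⊕ l ≗ span* y
  y⊕l≗span* zero = xor-cancelˡ (y zero) _
  y⊕l≗span* (suc zero) = xor-cancelˡ (y (suc zero)) _
  y⊕l≗span* (suc (suc zero)) = xor-cancelˡ (y (suc (suc zero))) _
  y⊕l≗span* (suc (suc (suc zero))) = xor-cancelˡ (y (suc (suc (suc zero)))) _
  y⊕l≗span* (suc (suc (suc (suc zero)))) = trans (xor-identityʳ _) (sym agrees₄)
  y⊕l≗span* (suc (suc (suc (suc (suc zero))))) = trans (xor-identityʳ _) (sym agrees₅)
  y⊕l≗span* (suc (suc (suc (suc (suc (suc zero)))))) = trans (xor-identityʳ _) (sym agrees₆)
  y~l : F₇*-cycle? (y ⊕ l) ≡ true
  y~l = trans (F₇*-cycle?-cong y⊕l≗span*) (F₇*-cycle?-span* y)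

module Quotient (N : Matroid 8) (a : Fin 8) {r : ℕ} (A : Matrix r 8)
                (N≈A : ∀ X → Indep N X ⇔ ColIndep A X) (N∖a≅F₇* : (N ∖ a) ≅ F₇*) where

  open Contraction N a A N≈A
  σ : Fin 7 ↔ Fin 7
  σ = proj₁ N∖a≅F₇*
  open Inverse σ using (to; from; strictlyInverseˡ; strictlyInverseʳ)

  span∖a : Sub 7 → Sub 7
  span∖a Y = span* (Y ∘ from) ∘ to

  B∖a : Sub 7
  B∖a = B₀ ∘ to

  span∖a-cycle : ∀ Y → Cycle∖a (span∖a Y)
  span∖a-cycle Y = Cycle∖a-⊕ (Cycle∖a-· (Y (from (# 4))) (circuit C₄-circuit))
                   (Cycle∖a-⊕ (Cycle∖a-· (Y (from (# 5))) (circuit C₅-circuit))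
                              (Cycle∖a-· (Y (from (# 6))) (circuit C₆-circuit)))
    where
    circuit : ∀ {C} → IsCircuit F₇* C → Cycle∖a (C ∘ to)
    circuit = deletion-circuit ∘ IsCircuit-≅ F₇*-ext N∖a≅F₇*

  B∖a-acyclic : Acyclic Cycle∖a B∖a
  B∖a-acyclic = deletion-acyclic (Equivalence.from (proj₂ N∖a≅F₇* B∖a)
    (F₇*-ext (λ k → cong B₀ (sym (strictlyInverseˡ k))) B₀-indep))

  residual∖a : ∀ Y → Y ⊕ span∖a Y ⊆ B∖a
  residual∖a Y j p = residual⊆B₀ (Y ∘ from) (to j)
    (subst (λ b → b xor span∖a Y j ≡ true) (cong Y (sym (strictlyInverseʳ j))) p)

  cycle∖a⇔F₇*-cycle : ∀ Y → Cycle∖a Y ⇔ F₇*-cycle? (Y ∘ from) ≡ true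
  cycle∖a⇔F₇*-cycle Y = ⇔-trans
    (cycle⇔span-fixed Cycle∖a-cong (λ {Y} {Z} → Cycle∖a-⊕ {Y} {Z}) span∖a B∖a-acyclic span∖a-cycle residual∖a Y)
    (mk⇔ (λ Y≗ → F₇*-cycle?-complete (Y ∘ from) λ k →
                    trans (Y≗ (from k)) (cong (span* (Y ∘ from)) (strictlyInverseˡ k)))
         (λ cyc j → trans (cong Y (sym (strictlyInverseʳ j))) (F₇*-cycle?-sound (Y ∘ from) cyc (to j))))

  coloop-or-cycleThrough : (∀ Y → ¬ IsCycle A (liftAt a true Y)) ⊎ ∃ λ W₀ → IsCycle A (liftAt a true W₀)
  coloop-or-cycleThrough with colIndep-or-cycle A (liftAt a true B∖a)
  ... | inj₁ indep = inj₁ λ Y cyc → true≢false (liftAt-at a true (Y ⊕ span∖a Y))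
      (indep _ (liftAt-mono a id (residual∖a Y)) (reduced Y cyc) a)
    where
    reduced : ∀ Y → IsCycle A (liftAt a true Y) → IsCycle A (liftAt a true (Y ⊕ span∖a Y))
    reduced Y cyc = IsCycle-cong A (liftAt-⊕ a true false Y (span∖a Y))
      (IsCycle-⊕ A {liftAt a true Y} {liftAt a false (span∖a Y)} cyc (span∖a-cycle Y))
  ... | inj₂ (W , W⊆ , cyc , i , Wi) with W a in Wa
  ...   | true  = inj₂ (W ∘ punchIn a , IsCycle-cong A (liftAt-η-at a W Wa) cyc)
  ...   | false = ⊥-elim (true≢false Wi (trans (liftAt-η-at a W Wa i)
      (liftAt-false-IsEmpty a (B∖a-acyclic _ (⊆-liftAt a W⊆) (IsCycle-cong A (liftAt-η-at a W Wa) cyc)) i)))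

  quotient-acyclic : ColIndep A ⁅ a ⁆ → ∀ {W₀} → IsCycle A (liftAt a true W₀) →
                     ∀ X → Indep (N / a) X ⇔ Acyclic (QuotientCycle (W₀ ∘ from)) (X ∘ from)
  quotient-acyclic nonloop {W₀} cycW₀ X = ⇔-trans (contract-acyclic nonloop cycW₀ X)
    (Acyclic-relabel σ (λ Y≗Z q → trans (sym (quotientCycle?-cong (W₀ ∘ from) Y≗Z)) q)
      (λ Y → ⊎⇔∨ (cycle∖a⇔F₇*-cycle Y) (cycle∖a⇔F₇*-cycle (Y ⊕ W₀))) X)

  classification : (N / a) ≅ F₇* ⊎ (N / a) ≅ F₇ ⊎ ∃ λ ends → (N / a) ≅ cycleMatroid {v = 4} ends
  classification with loop-or-nonloop
  ... | inj₁ loop = inj₁ (σ , λ X → ⇔-trans (contract-loop loop X) (proj₂ N∖a≅F₇* X))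
  ... | inj₂ nonloop with coloop-or-cycleThrough
  ...   | inj₁ coloop = inj₁ (σ , λ X → ⇔-trans (contract-coloop coloop X) (proj₂ N∖a≅F₇* X))
  ...   | inj₂ (W₀ , cycW₀) with classify (W₀ ∘ from)
  ...     | trivial cyc =
    ⊥-elim (loop-nonloop (loop-by-cycles cycW₀ (Equivalence.from (cycle∖a⇔F₇*-cycle W₀) cyc)) nonloop)
  ...     | fano ≡F₇ = inj₂ (inj₁ (σ , λ X → ⇔-trans (quotient-acyclic nonloop cycW₀ X)
      (mk⇔ (Acyclic-antitone (λ Z cyc → trans (≡F₇ Z) (isCycle?-complete fanoMatrix {Z} cyc)))
           (Acyclic-antitone (λ Z q → isCycle?-sound fanoMatrix {Z} (trans (sym (≡F₇ Z)) q))))))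
  ...     | graphic ends ≅G =
    inj₂ (inj₂ (ends , σ , λ X → ⇔-trans (quotient-acyclic nonloop cycW₀ X) (≅G (X ∘ from))))

lemma2p11 : ∀ {n} (N : Matroid (suc n)) (a : Fin (suc n)) →
    IsBinary N → (N ∖ a) ≅ F₇* →
    ¬ HasMinor (N / a) F₇ → ¬ HasMinor (N / a) F₇* →
    IsGraphic (N / a)
lemma2p11 N a (r , A , N≈A) N∖a≅F₇* noF₇ noF₇* with ↔⇒≡ (proj₁ N∖a≅F₇*)
... | refl with Quotient.classification N a A N≈A N∖a≅F₇*
... | inj₁ ≅F₇* = ⊥-elim (noF₇* (≅⇒HasMinor F₇*-ext F₇*-∅ ≅F₇*))
... | inj₂ (inj₁ ≅F₇) = ⊥-elim (noF₇ (≅⇒HasMinor F₇-ext F₇-∅ ≅F₇))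
... | inj₂ (inj₂ (ends , ≅G)) = ≅⇒IsGraphic {ends = ends} ≅G
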